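{- Let $1\le k\le n$ be integers, let $d$ be a positive divisor of $n$, and let $\omega$ be a primitive $d$-th root of unity. Let $f_{n,k}(q)=\frac{1}{[2n-k]_q}\begin{bmatrix} n\\ k-1\end{bmatrix}_q\begin{bmatrix} 3n-2k-1\\ n-k\end{bmatrix}_q$ and $f_{n,k}=f_{n,k}(1)=\frac{1}{2n-k}\binom{n}{k-1}\binom{3n-2k-1}{n-k}$. Then: (i) if $d=1$, then $f_{n,k}(\omega)=f_{n,k}$; (ii) if $d\ge 2$ and $d\mid k$, then with $n'=n/d$ and $k'=k/d$, $f_{n,k}(\omega)=(n'-k'+1)\,f_{n',k'}$, where $f_{n',k'}=\frac{1}{2n'-k'}\binom{n'}{k'-1}\binom{3n'-2k'-1}{n'-k'}$; (iii) if $d=2$ and $k$ is odd, then with $n'=n/2$ and $k'=(k+1)/2$, $f_{n,k}(\omega)=\binom{n'}{k'-1}\binom{3n'-2k'}{n'-k'}$; (iv) in all other cases, $f_{n,k}(\omega)=0$.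
   Context: Here $[m]_q=1+q+\dots+q^{m-1}$, $[m]_q!=[m]_q[m-1]_q\cdots[1]_q$, and $\begin{bmatrix} m\\ j\end{bmatrix}_q=\frac{[m]_q!}{[j]_q![m-j]_q!}$. The value $f_{n,k}(\omega)$ means the value at $q=\omega$ of the rational function $f_{n,k}(q)$ (after cancellation of common factors, i.e. its limit as $q\to\omega$). -}

module Defs where

open import Level using (Level; _⊔_)
open import Data.Nat using (ℕ; zero; suc; _∸_; _<_) renaming (_+_ to _+ℕ_; _*_ to _*ℕ_)
open import Data.Nat.Combinatorics using (_C_)
open import Data.List using (List; []; _∷_)
open import Data.Product using (Σ; _×_; _,_)
open import Data.Sum using (_⊎_)
open import Relation.Binary.PropositionalEquality using (_≡_)
open import Relation.Nullary using (¬_)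
open import Algebra.Bundles using (CommutativeRing)

module OverRing {c ℓ : Level} (R : CommutativeRing c ℓ) where
  open CommutativeRing R

  natR : ℕ → Carrier
  natR zero    = 0#
  natR (suc n) = 1# + natR n

  _^_ : Carrier → ℕ → Carrier
  x ^ zero  = 1#
  x ^ suc n = x * (x ^ n)

  IsIntegralDomain : Set (c ⊔ ℓ)
  IsIntegralDomain = (1# ≉ 0#) × (∀ x y → x * y ≈ 0# → (x ≈ 0#) ⊎ (y ≈ 0#))

  HasCharZero : Set ℓ
  HasCharZero = ∀ m → natR m ≈ 0# → m ≡ 0

  IsPrimitiveRoot : ℕ → Carrier → Set ℓ
  IsPrimitiveRoot d ω = (ω ^ d ≈ 1#) × (∀ j → 0 < j → j < d → ω ^ j ≉ 1#)

  -- Polynomials in q over R: coefficient lists, constant term first.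

  Poly : Set c
  Poly = List Carrier

  -- equality of polynomials: coefficientwise, missing coefficients are 0
  data _≈ₚ_ : Poly → Poly → Set (c ⊔ ℓ) where
    nil≈  : [] ≈ₚ []
    cons≈ : ∀ {x y xs ys} → x ≈ y → xs ≈ₚ ys → (x ∷ xs) ≈ₚ (y ∷ ys)
    nilˡ  : ∀ {y ys} → 0# ≈ y → [] ≈ₚ ys → [] ≈ₚ (y ∷ ys)
    nilʳ  : ∀ {x xs} → x ≈ 0# → xs ≈ₚ [] → (x ∷ xs) ≈ₚ []

  _+ₚ_ : Poly → Poly → Poly
  []       +ₚ ys       = ys
  (x ∷ xs) +ₚ []       = x ∷ xs
  (x ∷ xs) +ₚ (y ∷ ys) = (x + y) ∷ (xs +ₚ ys)

  scale : Carrier → Poly → Poly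
  scale a []       = []
  scale a (x ∷ xs) = (a * x) ∷ scale a xs

  _*ₚ_ : Poly → Poly → Poly
  []       *ₚ ys = []
  (x ∷ xs) *ₚ ys = scale x ys +ₚ (0# ∷ (xs *ₚ ys))

  eval : Poly → Carrier → Carrier
  eval []       a = 0#
  eval (x ∷ xs) a = x + a * eval xs a

  oneₚ : Poly
  oneₚ = 1# ∷ []

  -- q-integer [m]_q = 1 + q + ... + q^{m-1}
  qint : ℕ → Poly
  qint zero    = []
  qint (suc m) = 1# ∷ qint m

  qfact : ℕ → Poly
  qfact zero    = oneₚ
  qfact (suc m) = qint (suc m) *ₚ qfact m

  -- f_{n,k}(q) = (1/[2n-k]_q) [n choose k-1]_q [3n-2k-1 choose n-k]_q
  --           = numer n k / denom n k, with
  -- numer = [n]! [3n-2k-1]!,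
  -- denom = [2n-k] [k-1]! [n-k+1]! [n-k]! [2n-k-1]!
  numer : ℕ → ℕ → Poly
  numer n k = qfact n *ₚ qfact (3 *ℕ n ∸ 2 *ℕ k ∸ 1)

  denom : ℕ → ℕ → Poly
  denom n k = qint (2 *ℕ n ∸ k) *ₚ (qfact (k ∸ 1) *ₚ (qfact (n ∸ k +ℕ 1)
              *ₚ (qfact (n ∸ k) *ₚ qfact (2 *ℕ n ∸ k ∸ 1))))

  -- "The rational function N/D takes the value p/m at q = ω" (value after
  -- cancelling common factors): N/D = A/B as rational functions for some
  -- polynomials A, B with B(ω) ≠ 0, and A(ω)/B(ω) = p/m.
  RatValue : Poly → Poly → Carrier → ℕ → ℕ → Set (c ⊔ ℓ)
  RatValue N D ω p m =
    Σ Poly λ A → Σ Poly λ B →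
      (eval B ω ≉ 0#) × ((A *ₚ D) ≈ₚ (B *ₚ N)) × (eval A ω * natR m ≈ eval B ω * natR p)

  fValue : ℕ → ℕ → Carrier → ℕ → ℕ → Set (c ⊔ ℓ)
  fValue n k ω p m = RatValue (numer n k) (denom n k) ω p m

-- f_{n,k} = f_{n,k}(1) = (1/(2n-k)) C(n,k-1) C(3n-2k-1,n-k), recorded as
-- numerator / denominator (natural numbers)
fNum : ℕ → ℕ → ℕ
fNum n k = (n C (k ∸ 1)) *ℕ ((3 *ℕ n ∸ 2 *ℕ k ∸ 1) C (n ∸ k))

fDen : ℕ → ℕ → ℕ
fDen n k = 2 *ℕ n ∸ k

-- Put k = 1 + v and n = 1 + v + u, so that
--   f_{n,k}(q) = [1+v+u]! [v+3u]! / ([1+v+2u]! [v]! [1+u]! [u]!).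
-- At q = 1 each [m]_q becomes m. At a primitive d-th root of unity ω with d ≥ 2 we have [d]_ω = 0,
-- [s]_ω ≠ 0 for 0 < s < d, and [m]_ω depends only on m mod d; this gives the q-Lucas factorisation
--   [da + r]_q! = [d]_q^a P(q)   with   P(ω) = ([d-1]!_ω)^a a! [r]!_ω ≠ 0   (r < d).
-- So f_{n,k}(ω) is 0 when the numerator carries more factors [d]_q than the denominator, and a
-- ratio of ordinary factorials when the counts agree. Dividing the six factorial arguments by d,
-- the counts agree exactly when d ∣ k, or when d = 2 and k is odd; otherwise the numerator has more.

module Submission where

open import Defs
open import Level using (Level; _⊔_)
open import Algebra.Bundles using (CommutativeRing)
open import Data.List using ([]; _∷_)
open import Data.Product using (Σ; _×_; _,_; proj₁; proj₂)
open import Relation.Nullary using (contradiction)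
open import Data.Nat using (ℕ; zero; suc) renaming (_+_ to _+ℕ_; _*_ to _*ℕ_)

module RingArithmetic {c ℓ : Level} (R : CommutativeRing c ℓ) where
  open CommutativeRing R hiding (zero)
  open OverRing R
  open import Relation.Binary.PropositionalEquality as ≡ using (_≡_)
  open import Data.Nat using (_!; ≢-nonZero⁻¹)
  open import Relation.Binary.Reasoning.Setoid setoid
  open import Algebra.Solver.Ring.NaturalCoefficients.Default commutativeSemiring
  import Data.Nat.Properties as ℕ

  natR-+ : ∀ a b → natR (a +ℕ b) ≈ natR a + natR b
  natR-+ zero    b = sym (+-identityˡ _)
  natR-+ (suc a) b = trans (+-congˡ (natR-+ a b)) (sym (+-assoc _ _ _))

  natR-* : ∀ a b → natR (a *ℕ b) ≈ natR a * natR b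
  natR-* zero    b = sym (zeroˡ _)
  natR-* (suc a) b = begin
    natR (b +ℕ a *ℕ b)        ≈⟨ trans (natR-+ b (a *ℕ b)) (+-congˡ (natR-* a b)) ⟩
    natR b + natR a * natR b  ≈⟨ solve 2 (λ a b → b :+ a :* b := (con 1 :+ a) :* b) refl (natR a) (natR b) ⟩
    (1# + natR a) * natR b    ∎

  ^-cong : ∀ {x y} n → x ≈ y → x ^ n ≈ y ^ n
  ^-cong zero    x≈y = refl
  ^-cong (suc n) x≈y = *-cong x≈y (^-cong n x≈y)

  ^-homo-* : ∀ x m n → x ^ (m +ℕ n) ≈ x ^ m * x ^ n
  ^-homo-* x zero    n = sym (*-identityˡ _)
  ^-homo-* x (suc m) n = trans (*-congˡ (^-homo-* x m n)) (sym (*-assoc _ _ _))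

  ^-assocʳ : ∀ x m n → (x ^ m) ^ n ≈ x ^ (m *ℕ n)
  ^-assocʳ x m zero    rewrite ℕ.*-zeroʳ m = refl
  ^-assocʳ x m (suc n) rewrite ℕ.*-suc m n =
    trans (*-congˡ (^-assocʳ x m n)) (sym (^-homo-* x m (m *ℕ n)))

  natR[m!]≉0 : HasCharZero → ∀ m → natR (m !) ≉ 0#
  natR[m!]≉0 charZero m m!≈0 = ≢-nonZero⁻¹ (m !) {{ℕ._!≢0 m}} (charZero (m !) m!≈0)

  natR-cross : ∀ a₁ a₂ a₃ a₄ a₅ a₆ m p → (a₁ *ℕ a₂) *ℕ m ≡ (a₃ *ℕ (a₄ *ℕ (a₅ *ℕ a₆))) *ℕ p →
               (natR a₁ * natR a₂) * natR m ≈ (natR a₃ * (natR a₄ * (natR a₅ * natR a₆))) * natR p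
  natR-cross a₁ a₂ a₃ a₄ a₅ a₆ m p eq = begin
    (natR a₁ * natR a₂) * natR m                            ≈⟨ *-congʳ (natR-* a₁ a₂) ⟨
    natR (a₁ *ℕ a₂) * natR m                                ≈⟨ natR-* (a₁ *ℕ a₂) m ⟨
    natR ((a₁ *ℕ a₂) *ℕ m)                                  ≡⟨ ≡.cong natR eq ⟩
    natR ((a₃ *ℕ (a₄ *ℕ (a₅ *ℕ a₆))) *ℕ p)                  ≈⟨ natR-* (a₃ *ℕ (a₄ *ℕ (a₅ *ℕ a₆))) p ⟩
    natR (a₃ *ℕ (a₄ *ℕ (a₅ *ℕ a₆))) * natR p
      ≈⟨ *-congʳ (trans (natR-* a₃ _) (*-congˡ (trans (natR-* a₄ _) (*-congˡ (natR-* a₅ a₆))))) ⟩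
    (natR a₃ * (natR a₄ * (natR a₅ * natR a₆))) * natR p    ∎

  1^n≈1 : ∀ n → 1# ^ n ≈ 1#
  1^n≈1 zero    = refl
  1^n≈1 (suc n) = trans (*-identityˡ _) (1^n≈1 n)

module IntegralDomainProperties {c ℓ : Level} (R : CommutativeRing c ℓ)
                                (isID : OverRing.IsIntegralDomain R) where
  open CommutativeRing R hiding (zero)
  open OverRing R
  open import Relation.Binary.Reasoning.Setoid setoid
  open import Algebra.Properties.Ring ring using (-1*x≈-x)
  open import Algebra.Properties.Group +-group using (x∙y⁻¹≈ε⇒x≈y; x≈y⇒x∙y⁻¹≈ε)
  open import Data.Sum using (inj₁; inj₂)

  x≉0∧y≉0⇒x*y≉0 : ∀ {x y} → x ≉ 0# → y ≉ 0# → x * y ≉ 0#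
  x≉0∧y≉0⇒x*y≉0 x≉0 y≉0 xy≈0 with proj₂ isID _ _ xy≈0
  ... | inj₁ x≈0 = x≉0 x≈0
  ... | inj₂ y≈0 = y≉0 y≈0

  x≉0⇒x^n≉0 : ∀ {x} n → x ≉ 0# → x ^ n ≉ 0#
  x≉0⇒x^n≉0 zero    x≉0 = proj₁ isID
  x≉0⇒x^n≉0 (suc n) x≉0 = x≉0∧y≉0⇒x*y≉0 x≉0 (x≉0⇒x^n≉0 n x≉0)

  w≉1∧wx≈x⇒x≈0 : ∀ {w x} → w ≉ 1# → w * x ≈ x → x ≈ 0#
  w≉1∧wx≈x⇒x≈0 {w} {x} w≉1 wx≈x with proj₂ isID (w - 1#) x [w-1]x≈0
    where
    [w-1]x≈0 : (w - 1#) * x ≈ 0#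
    [w-1]x≈0 = begin
      (w - 1#) * x        ≈⟨ distribʳ x w (- 1#) ⟩
      w * x + - 1# * x    ≈⟨ +-congˡ (-1*x≈-x x) ⟩
      w * x - x           ≈⟨ x≈y⇒x∙y⁻¹≈ε wx≈x ⟩
      0#                  ∎
  ... | inj₁ w-1≈0 = contradiction (x∙y⁻¹≈ε⇒x≈y w 1# w-1≈0) w≉1
  ... | inj₂ x≈0   = x≈0

module PolynomialProperties {c ℓ : Level} (R : CommutativeRing c ℓ) where
  open CommutativeRing R hiding (zero)
  open OverRing R
  open import Relation.Binary.PropositionalEquality as ≡ using (_≡_)
  open import Relation.Binary.Reasoning.Setoid setoid
  open import Algebra.Solver.Ring.NaturalCoefficients.Default commutativeSemiring

  coeff : Poly → ℕ → Carrier
  coeff []       i       = 0#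
  coeff (x ∷ xs) zero    = x
  coeff (x ∷ xs) (suc i) = coeff xs i

  infix 4 _≋_
  _≋_ : Poly → Poly → Set _
  _≋_ = _≈ₚ_

  ≋⇒coeff≈ : ∀ {p q} → p ≋ q → ∀ i → coeff p i ≈ coeff q i
  ≋⇒coeff≈ nil≈         i       = refl
  ≋⇒coeff≈ (cons≈ x≈ _) zero    = x≈
  ≋⇒coeff≈ (cons≈ _ p≈) (suc i) = ≋⇒coeff≈ p≈ i
  ≋⇒coeff≈ (nilˡ x≈ _)  zero    = x≈
  ≋⇒coeff≈ (nilˡ _ p≈)  (suc i) = ≋⇒coeff≈ p≈ i
  ≋⇒coeff≈ (nilʳ x≈ _)  zero    = x≈
  ≋⇒coeff≈ (nilʳ _ p≈)  (suc i) = ≋⇒coeff≈ p≈ i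

  coeff≈⇒≋ : ∀ p q → (∀ i → coeff p i ≈ coeff q i) → p ≋ q
  coeff≈⇒≋ []       []       eq = nil≈
  coeff≈⇒≋ []       (y ∷ q)  eq = nilˡ (eq zero) (coeff≈⇒≋ [] q (λ i → eq (suc i)))
  coeff≈⇒≋ (x ∷ p)  []       eq = nilʳ (eq zero) (coeff≈⇒≋ p [] (λ i → eq (suc i)))
  coeff≈⇒≋ (x ∷ p)  (y ∷ q)  eq = cons≈ (eq zero) (coeff≈⇒≋ p q (λ i → eq (suc i)))

  ≋-refl : ∀ {p} → p ≋ p
  ≋-refl {p} = coeff≈⇒≋ p p (λ _ → refl)

  ≋-sym : ∀ {p q} → p ≋ q → q ≋ p
  ≋-sym {p} {q} p≈q = coeff≈⇒≋ q p (λ i → sym (≋⇒coeff≈ p≈q i))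

  ≋-trans : ∀ {p q r} → p ≋ q → q ≋ r → p ≋ r
  ≋-trans {p} {q} {r} p≈q q≈r =
    coeff≈⇒≋ p r (λ i → trans (≋⇒coeff≈ p≈q i) (≋⇒coeff≈ q≈r i))

  ≋-reflexive : ∀ {p q} → p ≡ q → p ≋ q
  ≋-reflexive ≡.refl = ≋-refl

  coeff-+ₚ : ∀ p q i → coeff (p +ₚ q) i ≈ coeff p i + coeff q i
  coeff-+ₚ []      q       i       = sym (+-identityˡ _)
  coeff-+ₚ (x ∷ p) []      i       = sym (+-identityʳ _)
  coeff-+ₚ (x ∷ p) (y ∷ q) zero    = refl
  coeff-+ₚ (x ∷ p) (y ∷ q) (suc i) = coeff-+ₚ p q i

  coeff-scale : ∀ a p i → coeff (scale a p) i ≈ a * coeff p i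
  coeff-scale a []      i       = sym (zeroʳ a)
  coeff-scale a (x ∷ p) zero    = refl
  coeff-scale a (x ∷ p) (suc i) = coeff-scale a p i

  +ₚ-cong : ∀ {p p′ q q′} → p ≋ p′ → q ≋ q′ → p +ₚ q ≋ p′ +ₚ q′
  +ₚ-cong {p} {p′} {q} {q′} p≈ q≈ = coeff≈⇒≋ _ _ λ i → begin
    coeff (p +ₚ q) i          ≈⟨ coeff-+ₚ p q i ⟩
    coeff p i + coeff q i     ≈⟨ +-cong (≋⇒coeff≈ p≈ i) (≋⇒coeff≈ q≈ i) ⟩
    coeff p′ i + coeff q′ i   ≈⟨ coeff-+ₚ p′ q′ i ⟨
    coeff (p′ +ₚ q′) i        ∎

  +ₚ-comm : ∀ p q → p +ₚ q ≋ q +ₚ p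
  +ₚ-comm p q = coeff≈⇒≋ _ _ λ i → begin
    coeff (p +ₚ q) i       ≈⟨ coeff-+ₚ p q i ⟩
    coeff p i + coeff q i  ≈⟨ +-comm _ _ ⟩
    coeff q i + coeff p i  ≈⟨ coeff-+ₚ q p i ⟨
    coeff (q +ₚ p) i       ∎

  +ₚ-assoc : ∀ p q r → (p +ₚ q) +ₚ r ≋ p +ₚ (q +ₚ r)
  +ₚ-assoc p q r = coeff≈⇒≋ _ _ λ i → begin
    coeff ((p +ₚ q) +ₚ r) i               ≈⟨ coeff-+ₚ (p +ₚ q) r i ⟩
    coeff (p +ₚ q) i + coeff r i          ≈⟨ +-congʳ (coeff-+ₚ p q i) ⟩
    (coeff p i + coeff q i) + coeff r i   ≈⟨ +-assoc _ _ _ ⟩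
    coeff p i + (coeff q i + coeff r i)   ≈⟨ +-congˡ (coeff-+ₚ q r i) ⟨
    coeff p i + coeff (q +ₚ r) i          ≈⟨ coeff-+ₚ p (q +ₚ r) i ⟨
    coeff (p +ₚ (q +ₚ r)) i               ∎

  +ₚ-swap : ∀ p q r → p +ₚ (q +ₚ r) ≋ q +ₚ (p +ₚ r)
  +ₚ-swap p q r = ≋-trans (≋-sym (+ₚ-assoc p q r)) (≋-trans (+ₚ-cong (+ₚ-comm p q) ≋-refl) (+ₚ-assoc q p r))

  +ₚ-identityʳ : ∀ p → p +ₚ [] ≋ p
  +ₚ-identityʳ []      = nil≈
  +ₚ-identityʳ (x ∷ p) = ≋-refl

  +ₚ-interchange : ∀ p q r s → (p +ₚ q) +ₚ (r +ₚ s) ≋ (p +ₚ r) +ₚ (q +ₚ s)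
  +ₚ-interchange p q r s = coeff≈⇒≋ _ _ λ i → begin
    coeff ((p +ₚ q) +ₚ (r +ₚ s)) i
      ≈⟨ trans (coeff-+ₚ (p +ₚ q) (r +ₚ s) i) (+-cong (coeff-+ₚ p q i) (coeff-+ₚ r s i)) ⟩
    (coeff p i + coeff q i) + (coeff r i + coeff s i)
      ≈⟨ solve 4 (λ p q r s → (p :+ q) :+ (r :+ s) := (p :+ r) :+ (q :+ s)) refl
           (coeff p i) (coeff q i) (coeff r i) (coeff s i) ⟩
    (coeff p i + coeff r i) + (coeff q i + coeff s i)
      ≈⟨ trans (coeff-+ₚ (p +ₚ r) (q +ₚ s) i) (+-cong (coeff-+ₚ p r i) (coeff-+ₚ q s i)) ⟨
    coeff ((p +ₚ r) +ₚ (q +ₚ s)) i ∎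

  scale-cong : ∀ {a b p q} → a ≈ b → p ≋ q → scale a p ≋ scale b q
  scale-cong {a} {b} {p} {q} a≈b p≋q = coeff≈⇒≋ _ _ λ i → begin
    coeff (scale a p) i  ≈⟨ coeff-scale a p i ⟩
    a * coeff p i        ≈⟨ *-cong a≈b (≋⇒coeff≈ p≋q i) ⟩
    b * coeff q i        ≈⟨ coeff-scale b q i ⟨
    coeff (scale b q) i  ∎

  scale-distribˡ : ∀ a p q → scale a (p +ₚ q) ≋ scale a p +ₚ scale a q
  scale-distribˡ a p q = coeff≈⇒≋ _ _ λ i → begin
    coeff (scale a (p +ₚ q)) i     ≈⟨ trans (coeff-scale a (p +ₚ q) i) (*-congˡ (coeff-+ₚ p q i)) ⟩
    a * (coeff p i + coeff q i)    ≈⟨ distribˡ _ _ _ ⟩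
    a * coeff p i + a * coeff q i  ≈⟨ trans (coeff-+ₚ (scale a p) (scale a q) i)
                                            (+-cong (coeff-scale a p i) (coeff-scale a q i)) ⟨
    coeff (scale a p +ₚ scale a q) i ∎

  scale-distribʳ : ∀ a b p → scale (a + b) p ≋ scale a p +ₚ scale b p
  scale-distribʳ a b p = coeff≈⇒≋ _ _ λ i → begin
    coeff (scale (a + b) p) i      ≈⟨ coeff-scale (a + b) p i ⟩
    (a + b) * coeff p i            ≈⟨ distribʳ _ _ _ ⟩
    a * coeff p i + b * coeff p i  ≈⟨ trans (coeff-+ₚ (scale a p) (scale b p) i)
                                            (+-cong (coeff-scale a p i) (coeff-scale b p i)) ⟨
    coeff (scale a p +ₚ scale b p) i ∎

  scale-assoc : ∀ a b p → scale a (scale b p) ≋ scale (a * b) p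
  scale-assoc a b p = coeff≈⇒≋ _ _ λ i → begin
    coeff (scale a (scale b p)) i  ≈⟨ trans (coeff-scale a (scale b p) i) (*-congˡ (coeff-scale b p i)) ⟩
    a * (b * coeff p i)            ≈⟨ *-assoc _ _ _ ⟨
    (a * b) * coeff p i            ≈⟨ coeff-scale (a * b) p i ⟨
    coeff (scale (a * b) p) i      ∎

  scale-zeroˡ : ∀ {a} p → a ≈ 0# → scale a p ≋ []
  scale-zeroˡ {a} p a≈0 = coeff≈⇒≋ _ _ λ i → begin
    coeff (scale a p) i  ≈⟨ coeff-scale a p i ⟩
    a * coeff p i        ≈⟨ *-congʳ a≈0 ⟩
    0# * coeff p i       ≈⟨ zeroˡ _ ⟩
    0#                   ∎

  scale-identityˡ : ∀ p → scale 1# p ≋ p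
  scale-identityˡ p = coeff≈⇒≋ _ _ λ i → trans (coeff-scale 1# p i) (*-identityˡ _)

  *ₚ-congˡ : ∀ {p p′} q → p ≋ p′ → p *ₚ q ≋ p′ *ₚ q
  *ₚ-congˡ q nil≈           = nil≈
  *ₚ-congˡ q (cons≈ x≈ p≋)  = +ₚ-cong (scale-cong x≈ ≋-refl) (cons≈ refl (*ₚ-congˡ q p≋))
  *ₚ-congˡ q (nilˡ 0≈ []≋)  = ≋-sym (≋-trans (+ₚ-cong (scale-zeroˡ q (sym 0≈)) ≋-refl)
                                            (nilʳ refl (≋-sym (*ₚ-congˡ q []≋))))
  *ₚ-congˡ q (nilʳ ≈0 ≋[])  = ≋-trans (+ₚ-cong (scale-zeroˡ q ≈0) ≋-refl) (nilʳ refl (*ₚ-congˡ q ≋[]))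

  *ₚ-congʳ : ∀ p {q q′} → q ≋ q′ → p *ₚ q ≋ p *ₚ q′
  *ₚ-congʳ []      q≋ = nil≈
  *ₚ-congʳ (x ∷ p) q≋ = +ₚ-cong (scale-cong refl q≋) (cons≈ refl (*ₚ-congʳ p q≋))

  *ₚ-cong : ∀ {p p′ q q′} → p ≋ p′ → q ≋ q′ → p *ₚ q ≋ p′ *ₚ q′
  *ₚ-cong {p′ = p′} {q = q} p≋ q≋ = ≋-trans (*ₚ-congˡ q p≋) (*ₚ-congʳ p′ q≋)

  *ₚ-zeroʳ : ∀ p → p *ₚ [] ≋ []
  *ₚ-zeroʳ []      = nil≈
  *ₚ-zeroʳ (x ∷ p) = nilʳ refl (*ₚ-zeroʳ p)

  *ₚ-∷ʳ : ∀ p x q → p *ₚ (x ∷ q) ≋ scale x p +ₚ (0# ∷ p *ₚ q)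
  *ₚ-∷ʳ []      x q = nilˡ refl nil≈
  *ₚ-∷ʳ (y ∷ p) x q = cons≈ (+-congʳ (*-comm y x))
    (≋-trans (+ₚ-cong ≋-refl (*ₚ-∷ʳ p x q)) (+ₚ-swap (scale y q) (scale x p) (0# ∷ p *ₚ q)))

  *ₚ-comm : ∀ p q → p *ₚ q ≋ q *ₚ p
  *ₚ-comm []      q = ≋-sym (*ₚ-zeroʳ q)
  *ₚ-comm (x ∷ p) q = ≋-sym (≋-trans (*ₚ-∷ʳ q x p) (+ₚ-cong ≋-refl (cons≈ refl (*ₚ-comm q p))))

  *ₚ-distribʳ : ∀ p p′ q → (p +ₚ p′) *ₚ q ≋ (p *ₚ q) +ₚ (p′ *ₚ q)
  *ₚ-distribʳ []      p′       q = ≋-refl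
  *ₚ-distribʳ (x ∷ p) []       q = ≋-sym (+ₚ-identityʳ _)
  *ₚ-distribʳ (x ∷ p) (y ∷ p′) q =
    ≋-trans (+ₚ-cong (scale-distribʳ x y q) (cons≈ (sym (+-identityʳ 0#)) (*ₚ-distribʳ p p′ q)))
            (+ₚ-interchange (scale x q) (scale y q) (0# ∷ p *ₚ q) (0# ∷ p′ *ₚ q))

  *ₚ-distribˡ : ∀ p q q′ → p *ₚ (q +ₚ q′) ≋ (p *ₚ q) +ₚ (p *ₚ q′)
  *ₚ-distribˡ p q q′ = ≋-trans (*ₚ-comm p (q +ₚ q′))
    (≋-trans (*ₚ-distribʳ q q′ p) (+ₚ-cong (*ₚ-comm q p) (*ₚ-comm q′ p)))

  scale-*ₚ : ∀ a p q → scale a p *ₚ q ≋ scale a (p *ₚ q)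
  scale-*ₚ a []      q = ≋-refl
  scale-*ₚ a (x ∷ p) q =
    ≋-trans (+ₚ-cong (≋-sym (scale-assoc a x q)) (cons≈ (sym (zeroʳ a)) (scale-*ₚ a p q)))
            (≋-sym (scale-distribˡ a (scale x q) (0# ∷ p *ₚ q)))

  *ₚ-assoc : ∀ p q r → (p *ₚ q) *ₚ r ≋ p *ₚ (q *ₚ r)
  *ₚ-assoc []      q r = nil≈
  *ₚ-assoc (x ∷ p) q r =
    ≋-trans (*ₚ-distribʳ (scale x q) (0# ∷ p *ₚ q) r)
            (+ₚ-cong (scale-*ₚ x q r)
                     (≋-trans (+ₚ-cong (scale-zeroˡ r refl) ≋-refl) (cons≈ refl (*ₚ-assoc p q r))))

  *ₚ-identityˡ : ∀ p → oneₚ *ₚ p ≋ p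
  *ₚ-identityˡ p = ≋-trans (+ₚ-cong (scale-identityˡ p) (nilʳ refl nil≈)) (+ₚ-identityʳ p)

  *ₚ-identityʳ : ∀ p → p *ₚ oneₚ ≋ p
  *ₚ-identityʳ p = ≋-trans (*ₚ-comm p oneₚ) (*ₚ-identityˡ p)

  *ₚ-swap : ∀ p q r → p *ₚ (q *ₚ r) ≋ q *ₚ (p *ₚ r)
  *ₚ-swap p q r = ≋-trans (≋-sym (*ₚ-assoc p q r)) (≋-trans (*ₚ-congˡ r (*ₚ-comm p q)) (*ₚ-assoc q p r))

  *ₚ-interchange : ∀ p q r s → (p *ₚ q) *ₚ (r *ₚ s) ≋ (p *ₚ r) *ₚ (q *ₚ s)
  *ₚ-interchange p q r s = ≋-trans (*ₚ-assoc p q (r *ₚ s))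
    (≋-trans (*ₚ-congʳ p (*ₚ-swap q r s)) (≋-sym (*ₚ-assoc p r (q *ₚ s))))


  eval-cong : ∀ {p q} x → p ≋ q → eval p x ≈ eval q x
  eval-cong x nil≈          = refl
  eval-cong x (cons≈ e p≋)  = +-cong e (*-congˡ (eval-cong x p≋))
  eval-cong x (nilˡ {y} {q} 0≈ p≋) = begin
    0#                ≈⟨ solve 1 (λ x → con 0 := con 0 :+ x :* con 0) refl x ⟩
    0# + x * 0#       ≈⟨ +-cong 0≈ (*-congˡ (eval-cong x p≋)) ⟩
    y + x * eval q x  ∎
  eval-cong x (nilʳ {y} {q} ≈0 p≋) = begin
    y + x * eval q x  ≈⟨ +-cong ≈0 (*-congˡ (eval-cong x p≋)) ⟩
    0# + x * 0#       ≈⟨ solve 1 (λ x → con 0 :+ x :* con 0 := con 0) refl x ⟩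
    0#                ∎

  eval-+ₚ : ∀ p q x → eval (p +ₚ q) x ≈ eval p x + eval q x
  eval-+ₚ []      q       x = sym (+-identityˡ _)
  eval-+ₚ (a ∷ p) []      x = sym (+-identityʳ _)
  eval-+ₚ (a ∷ p) (b ∷ q) x = begin
    (a + b) + x * eval (p +ₚ q) x        ≈⟨ +-congˡ (*-congˡ (eval-+ₚ p q x)) ⟩
    (a + b) + x * (eval p x + eval q x)  ≈⟨ solve 5 (λ a b x P Q → (a :+ b) :+ x :* (P :+ Q)
                                                      := (a :+ x :* P) :+ (b :+ x :* Q))
                                                   refl a b x (eval p x) (eval q x) ⟩
    (a + x * eval p x) + (b + x * eval q x) ∎

  eval-scale : ∀ a p x → eval (scale a p) x ≈ a * eval p x
  eval-scale a []      x = sym (zeroʳ a)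
  eval-scale a (b ∷ p) x = begin
    a * b + x * eval (scale a p) x  ≈⟨ +-congˡ (*-congˡ (eval-scale a p x)) ⟩
    a * b + x * (a * eval p x)      ≈⟨ solve 4 (λ a b x P → a :* b :+ x :* (a :* P) := a :* (b :+ x :* P))
                                             refl a b x (eval p x) ⟩
    a * (b + x * eval p x)          ∎

  eval-*ₚ : ∀ p q x → eval (p *ₚ q) x ≈ eval p x * eval q x
  eval-*ₚ []      q x = sym (zeroˡ _)
  eval-*ₚ (a ∷ p) q x = begin
    eval (scale a q +ₚ (0# ∷ p *ₚ q)) x          ≈⟨ eval-+ₚ (scale a q) (0# ∷ p *ₚ q) x ⟩
    eval (scale a q) x + (0# + x * eval (p *ₚ q) x)
      ≈⟨ +-cong (eval-scale a q x) (+-congˡ (*-congˡ (eval-*ₚ p q x))) ⟩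
    a * eval q x + (0# + x * (eval p x * eval q x))
      ≈⟨ solve 4 (λ a x P Q → a :* Q :+ (con 0 :+ x :* (P :* Q)) := (a :+ x :* P) :* Q)
               refl a x (eval p x) (eval q x) ⟩
    (a + x * eval p x) * eval q x                 ∎

  eval-oneₚ : ∀ x → eval oneₚ x ≈ 1#
  eval-oneₚ x = solve 1 (λ x → con 1 :+ x :* con 0 := con 1) refl x

  ratValue-resp : ∀ {N N′ D D′ ω p m} → N ≋ N′ → D ≋ D′ → RatValue N′ D′ ω p m → RatValue N D ω p m
  ratValue-resp N≋N′ D≋D′ (A , B , B≉0 , AD′≋BN′ , value) =
    A , B , B≉0 , ≋-trans (*ₚ-congʳ A D≋D′) (≋-trans AD′≋BN′ (*ₚ-congʳ B (≋-sym N≋N′))) , value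

  ratValue-common-factor : ∀ {N D C A B ω p m} → N ≋ C *ₚ A → D ≋ C *ₚ B → eval B ω ≉ 0# →
                           eval A ω * natR m ≈ eval B ω * natR p → RatValue N D ω p m
  ratValue-common-factor {N} {D} {C} {A} {B} N≋CA D≋CB B≉0 value = A , B , B≉0 , AD≋BN , value
    where
    AD≋BN : A *ₚ D ≋ B *ₚ N
    AD≋BN = ≋-trans (*ₚ-congʳ A D≋CB) (≋-trans (*ₚ-swap A C B) (≋-trans (*ₚ-congʳ C (*ₚ-comm A B))
              (≋-trans (*ₚ-swap C B A) (*ₚ-congʳ B (≋-sym N≋CA)))))

module QIntegers {c ℓ : Level} (R : CommutativeRing c ℓ) where
  open CommutativeRing R hiding (zero)
  open OverRing R
  open PolynomialProperties R
  open RingArithmetic R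
  open import Relation.Binary.Reasoning.Setoid setoid
  open import Algebra.Solver.Ring.NaturalCoefficients.Default commutativeSemiring
  open import Relation.Binary.PropositionalEquality as ≡ using (_≡_)
  import Data.Nat.Properties as ℕ

  infixr 30 _^ₚ_
  _^ₚ_ : Poly → ℕ → Poly
  p ^ₚ zero  = oneₚ
  p ^ₚ suc n = p *ₚ p ^ₚ n

  ^ₚ-homo-*ₚ : ∀ p m n → p ^ₚ (m +ℕ n) ≋ p ^ₚ m *ₚ p ^ₚ n
  ^ₚ-homo-*ₚ p zero    n = ≋-sym (*ₚ-identityˡ _)
  ^ₚ-homo-*ₚ p (suc m) n = ≋-trans (*ₚ-congʳ p (^ₚ-homo-*ₚ p m n)) (≋-sym (*ₚ-assoc p (p ^ₚ m) (p ^ₚ n)))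

  shift : ℕ → Poly → Poly
  shift zero    p = p
  shift (suc m) p = 0# ∷ shift m p

  shift-cong : ∀ m {p q} → p ≋ q → shift m p ≋ shift m q
  shift-cong zero    p≋q = p≋q
  shift-cong (suc m) p≋q = cons≈ refl (shift-cong m p≋q)

  eval-shift : ∀ m p x → eval (shift m p) x ≈ x ^ m * eval p x
  eval-shift zero    p x = sym (*-identityˡ _)
  eval-shift (suc m) p x = begin
    0# + x * eval (shift m p) x  ≈⟨ +-identityˡ _ ⟩
    x * eval (shift m p) x       ≈⟨ *-congˡ (eval-shift m p x) ⟩
    x * (x ^ m * eval p x)       ≈⟨ *-assoc _ _ _ ⟨
    x * x ^ m * eval p x         ∎

  *ₚ-shift : ∀ m p q → p *ₚ shift m q ≋ shift m (p *ₚ q)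
  *ₚ-shift zero    p q = ≋-refl
  *ₚ-shift (suc m) p q = ≋-trans (*ₚ-∷ʳ p 0# (shift m q))
    (≋-trans (+ₚ-cong (scale-zeroˡ p refl) ≋-refl) (cons≈ refl (*ₚ-shift m p q)))

  qint-+ : ∀ m n → qint (m +ℕ n) ≋ qint m +ₚ shift m (qint n)
  qint-+ zero    n = ≋-refl
  qint-+ (suc m) n = cons≈ (sym (+-identityʳ 1#)) (qint-+ m n)

  -- qintPower d a = [a]_{q^d}
  qintPower : ℕ → ℕ → Poly
  qintPower d zero    = []
  qintPower d (suc a) = oneₚ +ₚ shift d (qintPower d a)

  qint-* : ∀ d a → qint (d *ℕ a) ≋ qint d *ₚ qintPower d a
  qint-* d zero    rewrite ℕ.*-zeroʳ d = ≋-sym (*ₚ-zeroʳ (qint d))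
  qint-* d (suc a) rewrite ℕ.*-suc d a = ≋-trans (qint-+ d (d *ℕ a)) (≋-sym (≋-trans
    (*ₚ-distribˡ (qint d) oneₚ (shift d (qintPower d a)))
    (+ₚ-cong (*ₚ-identityʳ (qint d))
             (≋-trans (*ₚ-shift d (qint d) (qintPower d a)) (shift-cong d (≋-sym (qint-* d a)))))))

  eval-qintPower : ∀ d a x → x ^ d ≈ 1# → eval (qintPower d a) x ≈ natR a
  eval-qintPower d zero    x xᵈ≈1 = refl
  eval-qintPower d (suc a) x xᵈ≈1 = begin
    eval (oneₚ +ₚ shift d (qintPower d a)) x             ≈⟨ eval-+ₚ oneₚ (shift d (qintPower d a)) x ⟩
    eval oneₚ x + eval (shift d (qintPower d a)) x       ≈⟨ +-cong (eval-oneₚ x) (eval-shift d (qintPower d a) x) ⟩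
    1# + x ^ d * eval (qintPower d a) x                   ≈⟨ +-congˡ (*-cong xᵈ≈1 (eval-qintPower d a x xᵈ≈1)) ⟩
    1# + 1# * natR a                                      ≈⟨ +-congˡ (*-identityˡ _) ⟩
    1# + natR a                                           ∎

  -- (x - 1) [m]_x = x^m - 1, with both sides moved so that no subtraction occurs
  eval-qint : ∀ m x → eval (qint m) x + x ^ m ≈ 1# + x * eval (qint m) x
  eval-qint zero    x = solve 1 (λ x → con 0 :+ con 1 := con 1 :+ x :* con 0) refl x
  eval-qint (suc m) x = begin
    (1# + x * Q) + x * x ^ m  ≈⟨ solve 3 (λ x Q P → (con 1 :+ x :* Q) :+ x :* P := con 1 :+ x :* (Q :+ P))
                                        refl x Q (x ^ m) ⟩
    1# + x * (Q + x ^ m)      ≈⟨ +-congˡ (*-congˡ (eval-qint m x)) ⟩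
    1# + x * (1# + x * Q)     ∎
    where Q = eval (qint m) x

  qfact∣qfact-+ : ∀ n m → Σ Poly λ p → qfact (n +ℕ m) ≋ qfact m *ₚ p
  qfact∣qfact-+ zero    m = oneₚ , ≋-sym (*ₚ-identityʳ (qfact m))
  qfact∣qfact-+ (suc n) m with qfact∣qfact-+ n m
  ... | p , eq = qint (suc n +ℕ m) *ₚ p ,
    ≋-trans (*ₚ-congʳ (qint (suc n +ℕ m)) eq) (*ₚ-swap (qint (suc n +ℕ m)) (qfact m) p)

module PrimitiveRootOfUnity {c ℓ : Level} (R : CommutativeRing c ℓ) (isID : OverRing.IsIntegralDomain R)
                            (e : ℕ) (ω : CommutativeRing.Carrier R)
                            (isPrimitive : OverRing.IsPrimitiveRoot R (suc (suc e)) ω) where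
  open CommutativeRing R hiding (zero)
  open OverRing R
  open PolynomialProperties R
  open RingArithmetic R
  open QIntegers R
  open IntegralDomainProperties R isID
  open import Relation.Binary.Reasoning.Setoid setoid
  open import Algebra.Solver.Ring.NaturalCoefficients.Default commutativeSemiring
  open import Algebra.Properties.Group +-group using () renaming (∙-cancelˡ to +-cancelˡ)
  open import Relation.Binary.PropositionalEquality as ≡ using (_≡_)
  open import Data.Nat using (_<_; _!; s≤s; z≤n)
  import Data.Nat.Properties as ℕ

  d : ℕ
  d = suc (suc e)

  E : Poly
  E = qint d

  qfact[ω] : ℕ → Carrier
  qfact[ω] r = eval (qfact r) ω

  G : Carrier
  G = qfact[ω] (suc e)

  qfact[ω]0≈1 : qfact[ω] 0 ≈ 1#
  qfact[ω]0≈1 = eval-oneₚ ω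

  qfact[ω]1≈1 : qfact[ω] 1 ≈ 1#
  qfact[ω]1≈1 = trans (eval-*ₚ (qint 1) oneₚ ω) (trans (*-cong (eval-oneₚ ω) (eval-oneₚ ω)) (*-identityˡ 1#))

  ω≉1 : ω ≉ 1#
  ω≉1 ω≈1 = proj₂ isPrimitive 1 (s≤s z≤n) (s≤s (s≤s z≤n)) (trans (*-identityʳ ω) ω≈1)

  ω^[d*a]≈1 : ∀ a → ω ^ (d *ℕ a) ≈ 1#
  ω^[d*a]≈1 a = begin
    ω ^ (d *ℕ a)   ≈⟨ ^-assocʳ ω d a ⟨
    (ω ^ d) ^ a    ≈⟨ ^-cong a (proj₁ isPrimitive) ⟩
    1# ^ a         ≈⟨ 1^n≈1 a ⟩
    1#             ∎

  E[ω]≈0 : eval E ω ≈ 0#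
  E[ω]≈0 = w≉1∧wx≈x⇒x≈0 ω≉1 (+-cancelˡ 1# _ _ (begin
    1# + ω * X  ≈⟨ eval-qint d ω ⟨
    X + ω ^ d   ≈⟨ +-congˡ (proj₁ isPrimitive) ⟩
    X + 1#      ≈⟨ +-comm X 1# ⟩
    1# + X      ∎))
    where X = eval E ω

  qint[ω]≉0 : ∀ s → 0 < s → s < d → eval (qint s) ω ≉ 0#
  qint[ω]≉0 s 0<s s<d X≈0 = proj₂ isPrimitive s 0<s s<d (begin
    ω ^ s        ≈⟨ +-identityˡ _ ⟨
    0# + ω ^ s   ≈⟨ +-congʳ X≈0 ⟨
    X + ω ^ s    ≈⟨ eval-qint s ω ⟩
    1# + ω * X   ≈⟨ +-congˡ (trans (*-congˡ X≈0) (zeroʳ ω)) ⟩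
    1# + 0#      ≈⟨ +-identityʳ 1# ⟩
    1#           ∎)
    where X = eval (qint s) ω

  qfact[ω]≉0 : ∀ r → r < d → qfact[ω] r ≉ 0#
  qfact[ω]≉0 zero    r<d = λ 1≈0 → proj₁ isID (trans (sym (eval-oneₚ ω)) 1≈0)
  qfact[ω]≉0 (suc r) r<d eq = x≉0∧y≉0⇒x*y≉0 (qint[ω]≉0 (suc r) (s≤s z≤n) r<d)
    (qfact[ω]≉0 r (ℕ.<-trans (ℕ.n<1+n r) r<d)) (trans (sym (eval-*ₚ (qint (suc r)) (qfact r) ω)) eq)

  qint[ω]-periodic : ∀ a s → eval (qint (d *ℕ a +ℕ s)) ω ≈ eval (qint s) ω
  qint[ω]-periodic a s = begin
    eval (qint (d *ℕ a +ℕ s)) ω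
      ≈⟨ eval-cong ω (qint-+ (d *ℕ a) s) ⟩
    eval (qint (d *ℕ a) +ₚ shift (d *ℕ a) (qint s)) ω
      ≈⟨ trans (eval-+ₚ (qint (d *ℕ a)) (shift (d *ℕ a) (qint s)) ω)
               (+-cong (eval-cong ω (qint-* d a)) (eval-shift (d *ℕ a) (qint s) ω)) ⟩
    eval (E *ₚ qintPower d a) ω + ω ^ (d *ℕ a) * eval (qint s) ω
      ≈⟨ +-cong (trans (eval-*ₚ E (qintPower d a) ω) (trans (*-congʳ E[ω]≈0) (zeroˡ _)))
                (*-congʳ (ω^[d*a]≈1 a)) ⟩
    0# + 1# * eval (qint s) ω
      ≈⟨ trans (+-identityˡ _) (*-identityˡ _) ⟩
    eval (qint s) ω ∎

  splitValue : ℕ → ℕ → Carrier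
  splitValue a r = natR (a !) * qfact[ω] r

  record Splits (X : Poly) (a : ℕ) (x : Carrier) : Set (c ⊔ ℓ) where
    constructor splits
    field
      cofactor      : Poly
      factorization : X ≋ E ^ₚ a *ₚ cofactor
      cofactor[ω]   : eval cofactor ω ≈ G ^ a * x

  splits-*ₚ : ∀ {X Y a b x y} → Splits X a x → Splits Y b y → Splits (X *ₚ Y) (a +ℕ b) (x * y)
  splits-*ₚ {a = a} {b} {x} {y} (splits P X≋ P[ω]) (splits Q Y≋ Q[ω]) = splits
    (P *ₚ Q)
    (≋-trans (*ₚ-cong X≋ Y≋) (≋-trans (*ₚ-interchange (E ^ₚ a) P (E ^ₚ b) Q)
                                      (*ₚ-congˡ (P *ₚ Q) (≋-sym (^ₚ-homo-*ₚ E a b)))))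
    (begin
      eval (P *ₚ Q) ω            ≈⟨ trans (eval-*ₚ P Q ω) (*-cong P[ω] Q[ω]) ⟩
      (G ^ a * x) * (G ^ b * y)  ≈⟨ solve 4 (λ A B x y → (A :* x) :* (B :* y) := (A :* B) :* (x :* y))
                                           refl (G ^ a) (G ^ b) x y ⟩
      (G ^ a * G ^ b) * (x * y)  ≈⟨ *-congʳ (^-homo-* G a b) ⟨
      G ^ (a +ℕ b) * (x * y)     ∎)

  splits-trivially : ∀ X → Splits X 0 (eval X ω)
  splits-trivially X = splits X (≋-sym (*ₚ-identityˡ X)) (sym (*-identityˡ _))

  qfact-splits : ∀ a r → r < d → Splits (qfact (d *ℕ a +ℕ r)) a (splitValue a r)
  qfact-splits zero zero _ rewrite ℕ.*-zeroʳ d =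
    splits oneₚ (≋-sym (*ₚ-identityˡ oneₚ))
    (solve 1 (λ x → x := con 1 :* ((con 1 :+ con 0) :* x)) refl (eval oneₚ ω))
  qfact-splits a (suc r) r<d with qfact-splits a r (ℕ.<-trans (ℕ.n<1+n r) r<d)
  ... | splits P qfact≋ P[ω] rewrite ℕ.+-suc (d *ℕ a) r = splits
    (Q *ₚ P)
    (≋-trans (*ₚ-congʳ Q qfact≋) (*ₚ-swap Q (E ^ₚ a) P))
    (begin
      eval (Q *ₚ P) ω                              ≈⟨ trans (eval-*ₚ Q P ω) (*-cong Q[ω] P[ω]) ⟩
      [r+1] * (G ^ a * (natR (a !) * [r]!))
        ≈⟨ solve 4 (λ q g f h → q :* (g :* (f :* h)) := g :* (f :* (q :* h))) refl [r+1] (G ^ a) (natR (a !)) [r]! ⟩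
      G ^ a * (natR (a !) * ([r+1] * [r]!))        ≈⟨ *-congˡ (*-congˡ (eval-*ₚ (qint (suc r)) (qfact r) ω)) ⟨
      G ^ a * splitValue a (suc r)                  ∎)
    where
    Q = qint (suc (d *ℕ a +ℕ r))
    [r+1] = eval (qint (suc r)) ω
    [r]! = qfact[ω] r
    Q[ω] : eval Q ω ≈ [r+1]
    Q[ω] = ≡.subst (λ m → eval (qint m) ω ≈ [r+1]) (ℕ.+-suc (d *ℕ a) r) (qint[ω]-periodic a (suc r))
  qfact-splits (suc a) zero _ =
    ≡.subst (λ m → Splits (qfact m) (suc a) (splitValue (suc a) 0)) (≡.sym (d*[1+a]+0≡1+[d*a+[d-1]] a))
            (next-multiple a)
    where
    d*[1+a]+0≡1+[d*a+[d-1]] : ∀ a → d *ℕ suc a +ℕ 0 ≡ suc (d *ℕ a +ℕ suc e)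
    d*[1+a]+0≡1+[d*a+[d-1]] a =
      ≡.trans (ℕ.+-identityʳ _) (≡.trans (ℕ.*-suc d a) (≡.cong suc (ℕ.+-comm (suc e) (d *ℕ a))))
    next-multiple : ∀ a → Splits (qfact (suc (d *ℕ a +ℕ suc e))) (suc a) (splitValue (suc a) 0)
    next-multiple a with qfact-splits a (suc e) (ℕ.n<1+n (suc e))
    ... | splits P qfact≋ P[ω] = splits
      (Q *ₚ P)
      (≋-trans (*ₚ-cong E*Q≋ qfact≋) (*ₚ-interchange E Q (E ^ₚ a) P))
      (begin
        eval (Q *ₚ P) ω
          ≈⟨ trans (eval-*ₚ Q P ω) (*-cong (eval-qintPower d (suc a) ω (proj₁ isPrimitive)) P[ω]) ⟩
        natR (suc a) * (G ^ a * (natR (a !) * G))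
          ≈⟨ solve 4 (λ n g f G → n :* (g :* (f :* G)) := (G :* g) :* ((n :* f) :* con 1))
                     refl (natR (suc a)) (G ^ a) (natR (a !)) G ⟩
        G ^ suc a * ((natR (suc a) * natR (a !)) * 1#)
          ≈⟨ *-congˡ (*-cong (natR-* (suc a) (a !)) (eval-oneₚ ω)) ⟨
        G ^ suc a * splitValue (suc a) 0 ∎)
      where
      Q = qintPower d (suc a)
      E*Q≋ : qint (suc (d *ℕ a +ℕ suc e)) ≋ E *ₚ Q
      E*Q≋ = ≋-trans (≋-reflexive (≡.cong qint (≡.trans (≡.sym (d*[1+a]+0≡1+[d*a+[d-1]] a)) (ℕ.+-identityʳ _))))
                     (qint-* d (suc a))

  G≉0 : G ≉ 0#
  G≉0 = qfact[ω]≉0 (suc e) (ℕ.n<1+n (suc e))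

  splits-resp : ∀ {X Y a x} → X ≋ Y → Splits X a x → Splits Y a x
  splits-resp X≋Y (splits P X≋ P[ω]) = splits P (≋-trans (≋-sym X≋Y) X≋) P[ω]

  record Division (m : ℕ) : Set where
    constructor division
    field
      quotient remainder : ℕ
      property           : m ≡ d *ℕ quotient +ℕ remainder
      remainder<d        : remainder < d

    valueAtRoot : Carrier
    valueAtRoot = splitValue quotient remainder

  open Division public

  qfact-splits-exactly : ∀ {m} (D : Division m) → Splits (qfact m) (quotient D) (valueAtRoot D)
  qfact-splits-exactly (division a r ≡.refl r<d) = qfact-splits a r r<d

  qfact-splits-atLeast : ∀ {m} y a → m ≡ y +ℕ d *ℕ a → Σ Carrier (Splits (qfact m) a)
  qfact-splits-atLeast y a ≡.refl with qfact∣qfact-+ y (d *ℕ a +ℕ 0)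
  ... | Q , qfact≋ = _ , splits-resp
    (≋-trans (*ₚ-comm Q _) (≋-trans (≋-sym qfact≋) (≋-reflexive (≡.cong (λ m → qfact (y +ℕ m)) (ℕ.+-identityʳ _)))))
    (splits-*ₚ (splits-trivially Q) (qfact-splits a 0 (s≤s z≤n)))

  splitValue≉0 : HasCharZero → ∀ a r → r < d → splitValue a r ≉ 0#
  splitValue≉0 charZero a r r<d = x≉0∧y≉0⇒x*y≉0 (natR[m!]≉0 charZero a) (qfact[ω]≉0 r r<d)

  ratValue-splits : ∀ {N D s t x y} p m → Splits N s x → Splits D t y → s ≡ t → y ≉ 0# →
                    x * natR m ≈ y * natR p → RatValue N D ω p m
  ratValue-splits {s = s} {x = x} {y} p m (splits P N≋ P[ω]) (splits Q D≋ Q[ω]) ≡.refl y≉0 value =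
    ratValue-common-factor {C = E ^ₚ s} {P} {Q} {p = p} {m} N≋ D≋ Q[ω]≉0 (begin
      eval P ω * natR m    ≈⟨ trans (*-congʳ P[ω]) (*-assoc _ _ _) ⟩
      G ^ s * (x * natR m) ≈⟨ *-congˡ value ⟩
      G ^ s * (y * natR p) ≈⟨ trans (*-congʳ Q[ω]) (*-assoc _ _ _) ⟨
      eval Q ω * natR p    ∎)
    where
    Q[ω]≉0 : eval Q ω ≉ 0#
    Q[ω]≉0 Q≈0 = x≉0∧y≉0⇒x*y≉0 (x≉0⇒x^n≉0 s G≉0) y≉0 (trans (sym Q[ω]) Q≈0)

  ratValue-vanishes : ∀ {N D s t x y} → Splits N s x → Splits D t y → s ≡ suc t → y ≉ 0# → RatValue N D ω 0 1
  ratValue-vanishes {t = t} (splits P N≋ _) (splits Q D≋ Q[ω]) ≡.refl y≉0 =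
    ratValue-common-factor {C = E ^ₚ t} {E *ₚ P} {Q} {p = 0} {1}
      (≋-trans N≋ (≋-trans (*ₚ-assoc E (E ^ₚ t) P) (*ₚ-swap E (E ^ₚ t) P))) D≋ Q[ω]≉0 (begin
      eval (E *ₚ P) ω * natR 1       ≈⟨ *-congʳ (trans (eval-*ₚ E P ω) (*-congʳ E[ω]≈0)) ⟩
      (0# * eval P ω) * natR 1       ≈⟨ solve 2 (λ x y → (con 0 :* x) :* y := con 0) refl (eval P ω) (natR 1) ⟩
      0#                             ≈⟨ zeroʳ _ ⟨
      eval Q ω * natR 0              ∎)
    where
    Q[ω]≉0 : eval Q ω ≉ 0#
    Q[ω]≉0 Q≈0 = x≉0∧y≉0⇒x*y≉0 (x≉0⇒x^n≉0 t G≉0) y≉0 (trans (sym Q[ω]) Q≈0)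

module NatArithmetic where
  open import Data.Nat
  open import Data.Nat.Properties
  open import Data.Nat.Combinatorics using (_C_; nCk≡n!/k![n-k]!; k![n∸k]!∣n!)
  open import Data.Nat.DivMod using (m/n*n≡m; _%_; _/_; m≡m%n+[m/n]*n; m%n<n)
  open import Data.Nat.Divisibility using (_∣_; divides; ∣m+n∣m⇒∣n; ∣1⇒≡1)
  open import Data.Nat.Tactic.RingSolver using (solve-∀)
  open import Data.Product using (∃₂; _×_; _,_)
  open import Relation.Binary.PropositionalEquality
  open import Relation.Nullary using (¬_; contradiction)
  open ≡-Reasoning

  m≡n+o⇒m∸n≡o : ∀ {m n o} → m ≡ n + o → m ∸ n ≡ o
  m≡n+o⇒m∸n≡o {n = n} {o} refl = m+n∸m≡n n o

  nCj*[j!*r!]≡n! : ∀ {n} j r → j + r ≡ n → (n C j) * (j ! * r !) ≡ n !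
  nCj*[j!*r!]≡n! j r refl = begin
    ((j + r) C j) * (j ! * r !)                      ≡⟨ cong (_* (j ! * r !)) (nCk≡n!/k![n-k]! (m≤m+n j r)) ⟩
    ((j + r) ! / (j ! * (j + r ∸ j) !)) {{j !* (j + r ∸ j) !≢0}} * (j ! * r !)
      ≡⟨ cong (λ z → ((j + r) ! / (j ! * z !)) {{j !* z !≢0}} * (j ! * r !)) (m+n∸m≡n j r) ⟩
    ((j + r) ! / (j ! * r !)) {{j !* r !≢0}} * (j ! * r !)
      ≡⟨ m/n*n≡m {{j !* r !≢0}} (subst (λ z → j ! * z ! ∣ (j + r) !) (m+n∸m≡n j r) (k![n∸k]!∣n! (m≤m+n j r))) ⟩
    (j + r) ! ∎

  coordinates : ∀ {n k} → 1 ≤ k → k ≤ n → ∃₂ λ v u → k ≡ suc v × n ≡ suc v + u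
  coordinates {k = suc v} _ k≤n with m≤n⇒∃[o]m+o≡n k≤n
  ... | u , refl = v , u , refl , refl

  3[1+v+u]∸2[1+v]≡1+v+3u : ∀ v u → 3 * (suc v + u) ∸ 2 * suc v ≡ suc (v + 3 * u)
  3[1+v+u]∸2[1+v]≡1+v+3u v u = m≡n+o⇒m∸n≡o {n = 2 * suc v} (3[1+v+u]≡2[1+v]+[1+v+3u] v u)
    where
    3[1+v+u]≡2[1+v]+[1+v+3u] : ∀ v u → 3 * (suc v + u) ≡ 2 * suc v + suc (v + 3 * u)
    3[1+v+u]≡2[1+v]+[1+v+3u] = solve-∀

  3[1+v+u]∸2[1+v]∸1≡v+3u : ∀ v u → 3 * (suc v + u) ∸ 2 * suc v ∸ 1 ≡ v + 3 * u
  3[1+v+u]∸2[1+v]∸1≡v+3u v u = cong (_∸ 1) (3[1+v+u]∸2[1+v]≡1+v+3u v u)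

  2[1+v+u]∸[1+v]≡1+v+2u : ∀ v u → 2 * (suc v + u) ∸ suc v ≡ suc (v + 2 * u)
  2[1+v+u]∸[1+v]≡1+v+2u v u = m≡n+o⇒m∸n≡o {n = suc v} (2[1+v+u]≡[1+v]+[1+v+2u] v u)
    where
    2[1+v+u]≡[1+v]+[1+v+2u] : ∀ v u → 2 * (suc v + u) ≡ suc v + suc (v + 2 * u)
    2[1+v+u]≡[1+v]+[1+v+2u] = solve-∀

  fNum-coordinates : ∀ v u → fNum (suc v + u) (suc v) ≡ ((suc v + u) C v) * ((v + 3 * u) C u)
  fNum-coordinates v u rewrite 3[1+v+u]∸2[1+v]∸1≡v+3u v u | m+n∸m≡n v u = refl

  fDen-coordinates : ∀ v u → fDen (suc v + u) (suc v) ≡ suc (v + 2 * u)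
  fDen-coordinates = 2[1+v+u]∸[1+v]≡1+v+2u

  f-factorial-form : ∀ v u → ((suc v + u) ! * (v + 3 * u) !) * fDen (suc v + u) (suc v)
                       ≡ (suc (v + 2 * u) ! * (v ! * (suc u ! * u !))) * fNum (suc v + u) (suc v)
  f-factorial-form v u rewrite fDen-coordinates v u | fNum-coordinates v u = begin
    ((suc v + u) ! * (v + 3 * u) !) * suc (v + 2 * u)
      ≡⟨ cong₂ (λ x y → (x * y) * suc (v + 2 * u)) (nCj*[j!*r!]≡n! v (suc u) (+-suc v u))
                                                    (nCj*[j!*r!]≡n! u (v + 2 * u) (u+[v+2u]≡v+3u v u)) ⟨
    ((C₁ * (v ! * suc u !)) * (C₂ * (u ! * (v + 2 * u) !))) * suc (v + 2 * u)
      ≡⟨ rearrange C₁ C₂ (v !) (suc u !) (u !) ((v + 2 * u) !) (suc (v + 2 * u)) ⟩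
    ((suc (v + 2 * u) * (v + 2 * u) !) * (v ! * (suc u ! * u !))) * (C₁ * C₂) ∎
    where
    C₁ = (suc v + u) C v
    C₂ = (v + 3 * u) C u
    u+[v+2u]≡v+3u : ∀ v u → u + (v + 2 * u) ≡ v + 3 * u
    u+[v+2u]≡v+3u = solve-∀
    rearrange : ∀ c₁ c₂ a b c e s → ((c₁ * (a * b)) * (c₂ * (c * e))) * s ≡ ((s * e) * (a * (b * c))) * (c₁ * c₂)
    rearrange = solve-∀

  divisible-factorial-form : ∀ v u → ((suc v + u) ! * (v + 3 * u) !) * fDen (suc v + u) (suc v)
                               ≡ (suc (v + 2 * u) ! * (v ! * (u ! * u !)))
                                 * ((suc v + u ∸ suc v + 1) * fNum (suc v + u) (suc v))
  divisible-factorial-form v u = trans (f-factorial-form v u) (trans (rearrange (suc (v + 2 * u) !) (v !) (u !) u f)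
    (cong (λ t → (suc (v + 2 * u) ! * (v ! * (u ! * u !))) * ((t + 1) * f)) (sym (m+n∸m≡n v u))))
    where
    f = fNum (suc v + u) (suc v)
    rearrange : ∀ s a b u f → (s * (a * ((b + u * b) * b))) * f ≡ (s * (a * (b * b))) * ((u + 1) * f)
    rearrange = solve-∀

  odd-factorial-form : ∀ v u → ((suc v + u) ! * suc (v + 3 * u) !) * 1
                         ≡ (suc (v + 2 * u) ! * (v ! * (suc u ! * u !)))
                           * (((suc v + u) C (suc v ∸ 1)) * ((3 * (suc v + u) ∸ 2 * suc v) C (suc v + u ∸ suc v)))
  odd-factorial-form v u rewrite 3[1+v+u]∸2[1+v]≡1+v+3u v u | m+n∸m≡n v u = begin
    ((suc v + u) ! * suc (v + 3 * u) !) * 1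
      ≡⟨ cong₂ (λ x y → (x * y) * 1) (nCj*[j!*r!]≡n! v (suc u) (+-suc v u))
                                      (nCj*[j!*r!]≡n! u (suc (v + 2 * u)) (u+[1+v+2u]≡1+v+3u v u)) ⟨
    ((C₁ * (v ! * suc u !)) * (C₂ * (u ! * suc (v + 2 * u) !))) * 1
      ≡⟨ rearrange C₁ C₂ (v !) (suc u !) (u !) (suc (v + 2 * u) !) ⟩
    (suc (v + 2 * u) ! * (v ! * (suc u ! * u !))) * (C₁ * C₂) ∎
    where
    C₁ = (suc v + u) C v
    C₂ = suc (v + 3 * u) C u
    u+[1+v+2u]≡1+v+3u : ∀ v u → u + suc (v + 2 * u) ≡ suc (v + 3 * u)
    u+[1+v+2u]≡1+v+3u = solve-∀
    rearrange : ∀ c₁ c₂ a b c e → ((c₁ * (a * b)) * (c₂ * (c * e))) * 1 ≡ (e * (a * (b * c))) * (c₁ * c₂)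
    rearrange = solve-∀

  divisible-coordinates : ∀ e v u n′ k′ → let d = suc (suc e) in suc v + u ≡ d * n′ → suc v ≡ d * k′ →
    ∃₂ λ v′ u′ → k′ ≡ suc v′ × n′ ≡ suc v′ + u′ × v ≡ suc e + d * v′ × u ≡ d * u′
  divisible-coordinates e v u n′ zero    _   k≡ = contradiction (trans k≡ (*-zeroʳ (suc (suc e)))) λ ()
  divisible-coordinates e v u n′ (suc v′) n≡ k≡
    with m≤n⇒∃[o]m+o≡n (*-cancelˡ-≤ {suc v′} {n′} (suc (suc e))
                          (subst (_≤ suc (suc e) * n′) k≡ (subst (suc v ≤_) n≡ (m≤m+n (suc v) u))))
  ... | u′ , refl = v′ , u′ , refl , refl , suc-injective (trans k≡ (*-suc d v′)) ,
    +-cancelˡ-≡ (suc v) u (d * u′) (trans n≡ (trans (*-distribˡ-+ d (suc v′) u′) (cong (_+ d * u′) (sym k≡))))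
    where d = suc (suc e)

  1+v+1≡2[1+v′]⇒v≡2v′ : ∀ {v v′} → suc v + 1 ≡ 2 * suc v′ → v ≡ 2 * v′
  1+v+1≡2[1+v′]⇒v≡2v′ {v} {v′} eq =
    suc-injective (suc-injective (trans (cong suc (+-comm 1 v)) (trans eq (2[1+v′]≡2+2v′ v′))))
    where
    2[1+v′]≡2+2v′ : ∀ v′ → 2 * suc v′ ≡ suc (suc (2 * v′))
    2[1+v′]≡2+2v′ = solve-∀

  odd-coordinates : ∀ v u n′ k′ → suc v + u ≡ 2 * n′ → suc v + 1 ≡ 2 * k′ →
    ∃₂ λ v′ u′ → k′ ≡ suc v′ × n′ ≡ suc v′ + u′ × v ≡ 2 * v′ × u ≡ suc (2 * u′)
  odd-coordinates v u n′ zero     _  k≡ = contradiction k≡ (λ ())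
  odd-coordinates v u n′ (suc v′) n≡ k≡ with 1+v+1≡2[1+v′]⇒v≡2v′ k≡
  ... | refl with m≤n⇒∃[o]m+o≡n (*-cancelˡ-< 2 v′ n′ (subst (suc (2 * v′) ≤_) n≡ (m≤m+n (suc (2 * v′)) u)))
  ... | u′ , refl = v′ , u′ , refl , refl , refl ,
    +-cancelˡ-≡ (suc (2 * v′)) u (suc (2 * u′)) (trans n≡ (2[1+v′+u′]≡[1+2v′]+[1+2u′] v′ u′))
    where
    2[1+v′+u′]≡[1+2v′]+[1+2u′] : ∀ v′ u′ → 2 * (suc v′ + u′) ≡ suc (2 * v′) + suc (2 * u′)
    2[1+v′+u′]≡[1+2v′]+[1+2u′] = solve-∀

  euclidean-division : ∀ m d → .{{NonZero d}} → ∃₂ λ q r → r < d × m ≡ r + q * d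
  euclidean-division m d = m / d , m % d , m%n<n m d , m≡m%n+[m/n]*n m d

  nondivisible-coordinates : ∀ d v u → 2 ≤ d → d ∣ suc v + u → ¬ d ∣ suc v →
    ∃₂ λ r₀ w₀ → ∃₂ λ q u′ → d ≡ suc (suc (r₀ + w₀)) × v ≡ r₀ + d * q × u ≡ d * u′ + suc w₀
  nondivisible-coordinates (suc (suc f)) v u (s≤s (s≤s _)) (divides n″ n≡) d∤k
    with euclidean-division (suc v) (suc (suc f))
  ... | q , zero   , _   , k≡ = contradiction (divides q k≡) d∤k
  ... | q , suc r₀ , r<d , k≡ with m≤n⇒∃[o]m+o≡n r<d
  ... | w₀ , refl with m≤n⇒∃[o]m+o≡n (*-cancelʳ-< (suc (suc (r₀ + w₀))) q n″ (subst (q * suc (suc (r₀ + w₀)) <_) n≡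
                         (<-≤-trans (s≤s (m≤n+m _ r₀)) (subst (_≤ suc v + u) k≡ (m≤m+n (suc v) u)))))
  ... | u′ , refl = r₀ , w₀ , q , u′ , refl , trans (suc-injective k≡) (cong (r₀ +_) (*-comm q _)) ,
    +-cancelˡ-≡ (suc v) u (suc (suc (r₀ + w₀)) * u′ + suc w₀)
      (trans n≡ (trans (split-multiple r₀ w₀ q u′) (cong (_+ (suc (suc (r₀ + w₀)) * u′ + suc w₀)) (sym k≡))))
    where
    split-multiple : ∀ r₀ w₀ q u′ → (suc q + u′) * suc (suc (r₀ + w₀))
                                  ≡ (suc r₀ + q * suc (suc (r₀ + w₀))) + (suc (suc (r₀ + w₀)) * u′ + suc w₀)
    split-multiple = solve-∀

  ¬2∣1+2q : ∀ q → ¬ 2 ∣ suc (2 * q)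
  ¬2∣1+2q q 2∣1+2q
    with ∣1⇒≡1 (∣m+n∣m⇒∣n (subst (2 ∣_) (+-comm 1 (2 * q)) 2∣1+2q) (divides q (*-comm 2 q)))
  ... | ()

module Cases {c ℓ : Level} (R : CommutativeRing c ℓ) (isID : OverRing.IsIntegralDomain R)
             (charZero : OverRing.HasCharZero R) where
  open CommutativeRing R hiding (zero)
  open OverRing R
  open PolynomialProperties R
  open RingArithmetic R
  open QIntegers R
  open IntegralDomainProperties R isID
  open NatArithmetic
  open import Relation.Binary.Reasoning.Setoid setoid
  open import Algebra.Solver.Ring.NaturalCoefficients.Default commutativeSemiring
  open import Relation.Binary.PropositionalEquality as ≡ using (_≡_)
  open import Data.Nat using (_≤_; _!; _∸_; s≤s; z≤n)
  open import Data.Nat.Combinatorics using (_C_)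
  import Data.Nat.Properties as ℕ
  open import Data.Nat.Tactic.RingSolver using () renaming (solve to solve-ℕ)
  open import Data.Nat.Divisibility using (_∣_)
  open import Relation.Nullary using (¬_)

  -- f_{n,k}(q) in the coordinates k = 1 + v, n = 1 + v + u
  numerator : ℕ → ℕ → Poly
  numerator v u = qfact (suc v +ℕ u) *ₚ qfact (v +ℕ 3 *ℕ u)

  denominator : ℕ → ℕ → Poly
  denominator v u = qfact (suc (v +ℕ 2 *ℕ u)) *ₚ (qfact v *ₚ (qfact (suc u) *ₚ qfact u))

  fValue-coordinates : ∀ {ω} v u p m → RatValue (numerator v u) (denominator v u) ω p m →
                       fValue (suc v +ℕ u) (suc v) ω p m
  fValue-coordinates v u p m = ratValue-resp {p = p} {m} numer≋ (denom≋ (2[1+v+u]∸[1+v]≡1+v+2u v u)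
    (≡.trans (≡.cong (_+ℕ 1) (ℕ.m+n∸m≡n v u)) (ℕ.+-comm u 1)) (ℕ.m+n∸m≡n v u))
    where
    numer≋ : numer (suc v +ℕ u) (suc v) ≋ numerator v u
    numer≋ = ≋-reflexive (≡.cong (λ m → qfact (suc v +ℕ u) *ₚ qfact m) (3[1+v+u]∸2[1+v]∸1≡v+3u v u))
    -- the left side is denom n k with 2n - k, n - k + 1 and n - k abstracted
    denom≋ : ∀ {s b₁ b} → s ≡ suc (v +ℕ 2 *ℕ u) → b₁ ≡ suc u → b ≡ u →
             qint s *ₚ (qfact v *ₚ (qfact b₁ *ₚ (qfact b *ₚ qfact (s ∸ 1)))) ≋ denominator v u
    denom≋ ≡.refl ≡.refl ≡.refl =
      ≋-trans (*ₚ-congʳ (qint s) (≋-trans (*ₚ-congʳ (qfact v) F-to-front) (*ₚ-swap (qfact v) F rest)))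
              (≋-sym (*ₚ-assoc (qint s) F (qfact v *ₚ rest)))
      where
      s = suc (v +ℕ 2 *ℕ u)
      F = qfact (v +ℕ 2 *ℕ u)
      rest = qfact (suc u) *ₚ qfact u
      F-to-front : qfact (suc u) *ₚ (qfact u *ₚ F) ≋ F *ₚ rest
      F-to-front = ≋-trans (*ₚ-congʳ (qfact (suc u)) (*ₚ-comm (qfact u) F)) (*ₚ-swap (qfact (suc u)) F (qfact u))

  fValue-at-one : ∀ {ω} v u → ω ≈ 1# →
                  fValue (suc v +ℕ u) (suc v) ω (fNum (suc v +ℕ u) (suc v)) (fDen (suc v +ℕ u) (suc v))
  fValue-at-one {ω} v u ω≈1 = fValue-coordinates v u P M (ratValue-common-factor {C = oneₚ} {p = P} {M}
    (≋-sym (*ₚ-identityˡ _)) (≋-sym (*ₚ-identityˡ _)) denominator[1]≉0 (begin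
      eval (numerator v u) ω * natR M  ≈⟨ *-congʳ numerator[1] ⟩
      (natR a₁ * natR a₂) * natR M     ≈⟨ natR-cross a₁ a₂ a₃ a₄ a₅ a₆ M P (f-factorial-form v u) ⟩
      (natR a₃ * (natR a₄ * (natR a₅ * natR a₆))) * natR P  ≈⟨ *-congʳ denominator[1] ⟨
      eval (denominator v u) ω * natR P  ∎))
    where
    P = fNum (suc v +ℕ u) (suc v)
    M = fDen (suc v +ℕ u) (suc v)
    a₁ = (suc v +ℕ u) !
    a₂ = (v +ℕ 3 *ℕ u) !
    a₃ = suc (v +ℕ 2 *ℕ u) !
    a₄ = v !
    a₅ = suc u !
    a₆ = u !
    qint[1] : ∀ m → eval (qint m) ω ≈ natR m
    qint[1] zero    = refl
    qint[1] (suc m) = +-congˡ (trans (*-cong ω≈1 (qint[1] m)) (*-identityˡ _))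
    qfact[1] : ∀ m → eval (qfact m) ω ≈ natR (m !)
    qfact[1] zero    = trans (eval-oneₚ ω) (sym (+-identityʳ 1#))
    qfact[1] (suc m) = trans (eval-*ₚ (qint (suc m)) (qfact m) ω)
                             (trans (*-cong (qint[1] (suc m)) (qfact[1] m)) (sym (natR-* (suc m) (m !))))
    eval-qfact-* : ∀ m p → eval (qfact m *ₚ p) ω ≈ natR (m !) * eval p ω
    eval-qfact-* m p = trans (eval-*ₚ (qfact m) p ω) (*-congʳ (qfact[1] m))
    numerator[1] : eval (numerator v u) ω ≈ natR a₁ * natR a₂
    numerator[1] = trans (eval-qfact-* (suc v +ℕ u) _) (*-congˡ (qfact[1] (v +ℕ 3 *ℕ u)))
    denominator[1] : eval (denominator v u) ω ≈ natR a₃ * (natR a₄ * (natR a₅ * natR a₆))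
    denominator[1] = trans (eval-qfact-* (suc (v +ℕ 2 *ℕ u)) _) (*-congˡ (trans (eval-qfact-* v _)
                       (*-congˡ (trans (eval-qfact-* (suc u) _) (*-congˡ (qfact[1] u))))))
    denominator[1]≉0 : eval (denominator v u) ω ≉ 0#
    denominator[1]≉0 eq = x≉0∧y≉0⇒x*y≉0 (natR[m!]≉0 charZero (suc (v +ℕ 2 *ℕ u)))
      (x≉0∧y≉0⇒x*y≉0 (natR[m!]≉0 charZero v) (x≉0∧y≉0⇒x*y≉0 (natR[m!]≉0 charZero (suc u)) (natR[m!]≉0 charZero u)))
      (trans (sym denominator[1]) eq)

  module AtPrimitiveRoot (e : ℕ) (ω : Carrier) (isPrimitive : IsPrimitiveRoot (suc (suc e)) ω) where
    open PrimitiveRootOfUnity R isID e ω isPrimitive public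

    numerator-splits : ∀ v u (D₁ : Division (suc v +ℕ u)) (D₂ : Division (v +ℕ 3 *ℕ u)) →
                       Splits (numerator v u) (quotient D₁ +ℕ quotient D₂) (valueAtRoot D₁ * valueAtRoot D₂)
    numerator-splits v u D₁ D₂ = splits-*ₚ (qfact-splits-exactly D₁) (qfact-splits-exactly D₂)

    denominator-splits : ∀ v u (D₃ : Division (suc (v +ℕ 2 *ℕ u))) (D₄ : Division v)
                         (D₅ : Division (suc u)) (D₆ : Division u) →
      let y = valueAtRoot D₃ * (valueAtRoot D₄ * (valueAtRoot D₅ * valueAtRoot D₆)) in
      Splits (denominator v u) (quotient D₃ +ℕ (quotient D₄ +ℕ (quotient D₅ +ℕ quotient D₆))) y × y ≉ 0#
    denominator-splits v u D₃ D₄ D₅ D₆ =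
      splits-*ₚ (qfact-splits-exactly D₃) (splits-*ₚ (qfact-splits-exactly D₄)
                (splits-*ₚ (qfact-splits-exactly D₅) (qfact-splits-exactly D₆))) ,
      x≉0∧y≉0⇒x*y≉0 (valueAtRoot≉0 D₃) (x≉0∧y≉0⇒x*y≉0 (valueAtRoot≉0 D₄)
        (x≉0∧y≉0⇒x*y≉0 (valueAtRoot≉0 D₅) (valueAtRoot≉0 D₆)))
      where
      valueAtRoot≉0 : ∀ {m} (D : Division m) → valueAtRoot D ≉ 0#
      valueAtRoot≉0 (division a r _ r<d) = splitValue≉0 charZero a r r<d

    numerator-splits-atLeast : ∀ v u y₁ a₁ y₂ a₂ → suc v +ℕ u ≡ y₁ +ℕ d *ℕ a₁ → v +ℕ 3 *ℕ u ≡ y₂ +ℕ d *ℕ a₂ →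
                               Σ Carrier (Splits (numerator v u) (a₁ +ℕ a₂))
    numerator-splits-atLeast v u y₁ a₁ y₂ a₂ eq₁ eq₂ =
      _ , splits-*ₚ (proj₂ (qfact-splits-atLeast y₁ a₁ eq₁)) (proj₂ (qfact-splits-atLeast y₂ a₂ eq₂))

    splitValues-ratio : ∀ {m₁ m₂ m₃ m₄ m₅ m₆} (D₁ : Division m₁) (D₂ : Division m₂) (D₃ : Division m₃)
                          (D₄ : Division m₄) (D₅ : Division m₅) (D₆ : Division m₆) m p →
      let a = quotient; r = remainder in
      (a D₁ ! *ℕ a D₂ !) *ℕ m ≡ (a D₃ ! *ℕ (a D₄ ! *ℕ (a D₅ ! *ℕ a D₆ !))) *ℕ p →
      qfact[ω] (r D₁) * qfact[ω] (r D₂) ≈ qfact[ω] (r D₃) * (qfact[ω] (r D₄) * (qfact[ω] (r D₅) * qfact[ω] (r D₆))) →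
      (valueAtRoot D₁ * valueAtRoot D₂) * natR m
        ≈ (valueAtRoot D₃ * (valueAtRoot D₄ * (valueAtRoot D₅ * valueAtRoot D₆))) * natR p
    splitValues-ratio D₁ D₂ D₃ D₄ D₅ D₆ m p factorials remainders = begin
      (valueAtRoot D₁ * valueAtRoot D₂) * natR m
        ≈⟨ solve 5 (λ f₁ h₁ f₂ h₂ m → ((f₁ :* h₁) :* (f₂ :* h₂)) :* m := (h₁ :* h₂) :* ((f₁ :* f₂) :* m))
                 refl (f D₁) (h D₁) (f D₂) (h D₂) (natR m) ⟩
      (h D₁ * h D₂) * ((f D₁ * f D₂) * natR m)
        ≈⟨ *-cong remainders (natR-cross (a D₁ !) (a D₂ !) (a D₃ !) (a D₄ !) (a D₅ !) (a D₆ !) m p factorials) ⟩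
      (h D₃ * (h D₄ * (h D₅ * h D₆))) * ((f D₃ * (f D₄ * (f D₅ * f D₆))) * natR p)
        ≈⟨ solve 9 (λ f₃ h₃ f₄ h₄ f₅ h₅ f₆ h₆ p →
                      (h₃ :* (h₄ :* (h₅ :* h₆))) :* ((f₃ :* (f₄ :* (f₅ :* f₆))) :* p)
                      := ((f₃ :* h₃) :* ((f₄ :* h₄) :* ((f₅ :* h₅) :* (f₆ :* h₆)))) :* p)
                 refl (f D₃) (h D₃) (f D₄) (h D₄) (f D₅) (h D₅) (f D₆) (h D₆) (natR p) ⟩
      (valueAtRoot D₃ * (valueAtRoot D₄ * (valueAtRoot D₅ * valueAtRoot D₆))) * natR p ∎
      where
      a = quotient
      f : ∀ {m} → Division m → Carrier
      f D = natR (quotient D !)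
      h : ∀ {m} → Division m → Carrier
      h D = qfact[ω] (remainder D)

  fValue-divisible : ∀ e {ω} → IsPrimitiveRoot (suc (suc e)) ω → ∀ v′ u′ →
    let d = suc (suc e) ; v = suc e +ℕ d *ℕ v′ ; n′ = suc v′ +ℕ u′ ; k′ = suc v′ in
    fValue (suc v +ℕ d *ℕ u′) (suc v) ω ((n′ ∸ k′ +ℕ 1) *ℕ fNum n′ k′) (fDen n′ k′)
  fValue-divisible e {ω} isPrimitive v′ u′ = fValue-coordinates v u P M
    (ratValue-splits P M (numerator-splits v u D₁ D₂) (proj₁ denominator-split) exponents (proj₂ denominator-split)
      (splitValues-ratio D₁ D₂ D₃ D₄ D₅ D₆ M P (divisible-factorial-form v′ u′) remainders))
    where
    open AtPrimitiveRoot e ω isPrimitive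
    v = suc e +ℕ d *ℕ v′
    u = d *ℕ u′
    P = (suc v′ +ℕ u′ ∸ suc v′ +ℕ 1) *ℕ fNum (suc v′ +ℕ u′) (suc v′)
    M = fDen (suc v′ +ℕ u′) (suc v′)
    eq₁ : suc (suc e +ℕ suc (suc e) *ℕ v′) +ℕ suc (suc e) *ℕ u′ ≡ suc (suc e) *ℕ (suc v′ +ℕ u′) +ℕ 0
    eq₁ = solve-ℕ (e ∷ v′ ∷ u′ ∷ [])
    eq₂ : (suc e +ℕ suc (suc e) *ℕ v′) +ℕ 3 *ℕ (suc (suc e) *ℕ u′) ≡ suc (suc e) *ℕ (v′ +ℕ 3 *ℕ u′) +ℕ suc e
    eq₂ = solve-ℕ (e ∷ v′ ∷ u′ ∷ [])
    eq₃ : suc ((suc e +ℕ suc (suc e) *ℕ v′) +ℕ 2 *ℕ (suc (suc e) *ℕ u′)) ≡ suc (suc e) *ℕ suc (v′ +ℕ 2 *ℕ u′) +ℕ 0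
    eq₃ = solve-ℕ (e ∷ v′ ∷ u′ ∷ [])
    D₁ = division (suc v′ +ℕ u′) 0 eq₁ (s≤s z≤n)
    D₂ = division (v′ +ℕ 3 *ℕ u′) (suc e) eq₂ (ℕ.n<1+n (suc e))
    D₃ = division (suc (v′ +ℕ 2 *ℕ u′)) 0 eq₃ (s≤s z≤n)
    D₄ = division v′ (suc e) (ℕ.+-comm (suc e) (d *ℕ v′)) (ℕ.n<1+n (suc e))
    D₅ = division u′ 1 (ℕ.+-comm 1 u) (s≤s (s≤s z≤n))
    D₆ = division u′ 0 (≡.sym (ℕ.+-identityʳ u)) (s≤s z≤n)
    denominator-split = denominator-splits v u D₃ D₄ D₅ D₆
    exponents : (suc v′ +ℕ u′) +ℕ (v′ +ℕ 3 *ℕ u′) ≡ suc (v′ +ℕ 2 *ℕ u′) +ℕ (v′ +ℕ (u′ +ℕ u′))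
    exponents = solve-ℕ (v′ ∷ u′ ∷ [])
    remainders : qfact[ω] 0 * qfact[ω] (suc e) ≈ qfact[ω] 0 * (qfact[ω] (suc e) * (qfact[ω] 1 * qfact[ω] 0))
    remainders = *-congˡ (sym (trans (*-congˡ (trans (*-cong qfact[ω]1≈1 qfact[ω]0≈1) (*-identityˡ 1#)))
                                     (*-identityʳ _)))

  fValue-odd : ∀ {ω} → IsPrimitiveRoot 2 ω → ∀ v′ u′ →
    let n′ = suc v′ +ℕ u′ ; k′ = suc v′ in
    fValue (suc (2 *ℕ v′) +ℕ suc (2 *ℕ u′)) (suc (2 *ℕ v′)) ω ((n′ C (k′ ∸ 1)) *ℕ ((3 *ℕ n′ ∸ 2 *ℕ k′) C (n′ ∸ k′))) 1
  fValue-odd {ω} isPrimitive v′ u′ = fValue-coordinates v u P 1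
    (ratValue-splits P 1 (numerator-splits v u D₁ D₂) (proj₁ denominator-split) exponents (proj₂ denominator-split)
      (splitValues-ratio D₁ D₂ D₃ D₄ D₅ D₆ 1 P (odd-factorial-form v′ u′) remainders))
    where
    open AtPrimitiveRoot 0 ω isPrimitive
    v = 2 *ℕ v′
    u = suc (2 *ℕ u′)
    P = ((suc v′ +ℕ u′) C (suc v′ ∸ 1)) *ℕ ((3 *ℕ (suc v′ +ℕ u′) ∸ 2 *ℕ suc v′) C (suc v′ +ℕ u′ ∸ suc v′))
    eq₁ : suc (2 *ℕ v′) +ℕ suc (2 *ℕ u′) ≡ 2 *ℕ (suc v′ +ℕ u′) +ℕ 0
    eq₁ = solve-ℕ (v′ ∷ u′ ∷ [])
    eq₂ : 2 *ℕ v′ +ℕ 3 *ℕ suc (2 *ℕ u′) ≡ 2 *ℕ suc (v′ +ℕ 3 *ℕ u′) +ℕ 1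
    eq₂ = solve-ℕ (v′ ∷ u′ ∷ [])
    eq₃ : suc (2 *ℕ v′ +ℕ 2 *ℕ suc (2 *ℕ u′)) ≡ 2 *ℕ suc (v′ +ℕ 2 *ℕ u′) +ℕ 1
    eq₃ = solve-ℕ (v′ ∷ u′ ∷ [])
    eq₅ : suc (suc (2 *ℕ u′)) ≡ 2 *ℕ suc u′ +ℕ 0
    eq₅ = solve-ℕ (u′ ∷ [])
    D₁ = division (suc v′ +ℕ u′) 0 eq₁ (s≤s z≤n)
    D₂ = division (suc (v′ +ℕ 3 *ℕ u′)) 1 eq₂ (s≤s (s≤s z≤n))
    D₃ = division (suc (v′ +ℕ 2 *ℕ u′)) 1 eq₃ (s≤s (s≤s z≤n))
    D₄ = division v′ 0 (≡.sym (ℕ.+-identityʳ v)) (s≤s z≤n)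
    D₅ = division (suc u′) 0 eq₅ (s≤s z≤n)
    D₆ = division u′ 1 (ℕ.+-comm 1 (2 *ℕ u′)) (s≤s (s≤s z≤n))
    denominator-split = denominator-splits v u D₃ D₄ D₅ D₆
    exponents : (suc v′ +ℕ u′) +ℕ suc (v′ +ℕ 3 *ℕ u′) ≡ suc (v′ +ℕ 2 *ℕ u′) +ℕ (v′ +ℕ (suc u′ +ℕ u′))
    exponents = solve-ℕ (v′ ∷ u′ ∷ [])
    remainders : qfact[ω] 0 * qfact[ω] 1 ≈ qfact[ω] 1 * (qfact[ω] 0 * (qfact[ω] 0 * qfact[ω] 1))
    remainders = begin
      qfact[ω] 0 * qfact[ω] 1
        ≈⟨ *-cong qfact[ω]0≈1 qfact[ω]1≈1 ⟩
      1# * 1#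
        ≈⟨ solve 0 (con 1 :* con 1 := con 1 :* (con 1 :* (con 1 :* con 1))) refl ⟩
      1# * (1# * (1# * 1#))
        ≈⟨ *-cong qfact[ω]1≈1 (*-cong qfact[ω]0≈1 (*-cong qfact[ω]0≈1 qfact[ω]1≈1)) ⟨
      qfact[ω] 1 * (qfact[ω] 0 * (qfact[ω] 0 * qfact[ω] 1)) ∎

  fValue-vanishes-at-remainder-one : ∀ w₁ {ω} → IsPrimitiveRoot (3 +ℕ w₁) ω → ∀ q u′ →
    let d = 3 +ℕ w₁ in fValue (suc (d *ℕ q) +ℕ (d *ℕ u′ +ℕ suc (suc w₁))) (suc (d *ℕ q)) ω 0 1
  fValue-vanishes-at-remainder-one w₁ {ω} isPrimitive q u′ = fValue-coordinates v u 0 1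
    (ratValue-vanishes (proj₂ (numerator-splits-atLeast v u 0 (suc (q +ℕ u′)) w₁ (suc (suc (q +ℕ 3 *ℕ u′))) eq₁ eq₂))
      (proj₁ denominator-split) exponents (proj₂ denominator-split))
    where
    open AtPrimitiveRoot (suc w₁) ω isPrimitive
    v = d *ℕ q
    u = d *ℕ u′ +ℕ suc (suc w₁)
    eq₁ : suc ((3 +ℕ w₁) *ℕ q) +ℕ ((3 +ℕ w₁) *ℕ u′ +ℕ suc (suc w₁)) ≡ 0 +ℕ (3 +ℕ w₁) *ℕ suc (q +ℕ u′)
    eq₁ = solve-ℕ (w₁ ∷ q ∷ u′ ∷ [])
    eq₂ : (3 +ℕ w₁) *ℕ q +ℕ 3 *ℕ ((3 +ℕ w₁) *ℕ u′ +ℕ suc (suc w₁)) ≡ w₁ +ℕ (3 +ℕ w₁) *ℕ suc (suc (q +ℕ 3 *ℕ u′))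
    eq₂ = solve-ℕ (w₁ ∷ q ∷ u′ ∷ [])
    eq₃ : suc ((3 +ℕ w₁) *ℕ q +ℕ 2 *ℕ ((3 +ℕ w₁) *ℕ u′ +ℕ suc (suc w₁)))
          ≡ (3 +ℕ w₁) *ℕ suc (q +ℕ 2 *ℕ u′) +ℕ suc (suc w₁)
    eq₃ = solve-ℕ (w₁ ∷ q ∷ u′ ∷ [])
    eq₅ : suc ((3 +ℕ w₁) *ℕ u′ +ℕ suc (suc w₁)) ≡ (3 +ℕ w₁) *ℕ suc u′ +ℕ 0
    eq₅ = solve-ℕ (w₁ ∷ u′ ∷ [])
    D₃ = division (suc (q +ℕ 2 *ℕ u′)) (suc (suc w₁)) eq₃ (ℕ.n<1+n (suc (suc w₁)))
    D₄ = division q 0 (≡.sym (ℕ.+-identityʳ v)) (s≤s z≤n)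
    D₅ = division (suc u′) 0 eq₅ (s≤s z≤n)
    D₆ = division u′ (suc (suc w₁)) ≡.refl (ℕ.n<1+n (suc (suc w₁)))
    denominator-split = denominator-splits v u D₃ D₄ D₅ D₆
    exponents : suc (q +ℕ u′) +ℕ suc (suc (q +ℕ 3 *ℕ u′)) ≡ suc (suc (q +ℕ 2 *ℕ u′) +ℕ (q +ℕ (suc u′ +ℕ u′)))
    exponents = solve-ℕ (q ∷ u′ ∷ [])

  fValue-vanishes-at-remainder-≥2 : ∀ r₁ w₀ {ω} → IsPrimitiveRoot (suc (suc (suc r₁ +ℕ w₀))) ω → ∀ q u′ →
    let d = suc (suc (suc r₁ +ℕ w₀)) in
    fValue (suc (suc r₁ +ℕ d *ℕ q) +ℕ (d *ℕ u′ +ℕ suc w₀)) (suc (suc r₁ +ℕ d *ℕ q)) ω 0 1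
  fValue-vanishes-at-remainder-≥2 r₁ w₀ {ω} isPrimitive q u′ = fValue-coordinates v u 0 1
    (ratValue-vanishes
      (proj₂ (numerator-splits-atLeast v u 0 (suc (q +ℕ u′)) (suc (2 *ℕ w₀)) (suc (q +ℕ 3 *ℕ u′)) eq₁ eq₂))
      (proj₁ denominator-split) exponents (proj₂ denominator-split))
    where
    open AtPrimitiveRoot (suc r₁ +ℕ w₀) ω isPrimitive
    v = suc r₁ +ℕ d *ℕ q
    u = d *ℕ u′ +ℕ suc w₀
    eq₁ : suc (suc r₁ +ℕ suc (suc (suc r₁ +ℕ w₀)) *ℕ q) +ℕ (suc (suc (suc r₁ +ℕ w₀)) *ℕ u′ +ℕ suc w₀)
          ≡ 0 +ℕ suc (suc (suc r₁ +ℕ w₀)) *ℕ suc (q +ℕ u′)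
    eq₁ = solve-ℕ (r₁ ∷ w₀ ∷ q ∷ u′ ∷ [])
    eq₂ : (suc r₁ +ℕ suc (suc (suc r₁ +ℕ w₀)) *ℕ q) +ℕ 3 *ℕ (suc (suc (suc r₁ +ℕ w₀)) *ℕ u′ +ℕ suc w₀)
          ≡ suc (2 *ℕ w₀) +ℕ suc (suc (suc r₁ +ℕ w₀)) *ℕ suc (q +ℕ 3 *ℕ u′)
    eq₂ = solve-ℕ (r₁ ∷ w₀ ∷ q ∷ u′ ∷ [])
    eq₃ : suc ((suc r₁ +ℕ suc (suc (suc r₁ +ℕ w₀)) *ℕ q) +ℕ 2 *ℕ (suc (suc (suc r₁ +ℕ w₀)) *ℕ u′ +ℕ suc w₀))
          ≡ suc (suc (suc r₁ +ℕ w₀)) *ℕ suc (q +ℕ 2 *ℕ u′) +ℕ suc w₀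
    eq₃ = solve-ℕ (r₁ ∷ w₀ ∷ q ∷ u′ ∷ [])
    D₃ = division (suc (q +ℕ 2 *ℕ u′)) (suc w₀) eq₃ (s≤s (s≤s (ℕ.m≤n⇒m≤1+n (ℕ.m≤n+m w₀ r₁))))
    D₄ = division q (suc r₁) (ℕ.+-comm (suc r₁) (d *ℕ q)) (s≤s (s≤s (ℕ.m≤n⇒m≤1+n (ℕ.m≤m+n r₁ w₀))))
    D₅ = division u′ (suc (suc w₀)) (≡.sym (ℕ.+-suc (d *ℕ u′) (suc w₀))) (s≤s (s≤s (s≤s (ℕ.m≤n+m w₀ r₁))))
    D₆ = division u′ (suc w₀) ≡.refl (s≤s (s≤s (ℕ.m≤n⇒m≤1+n (ℕ.m≤n+m w₀ r₁))))
    denominator-split = denominator-splits v u D₃ D₄ D₅ D₆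
    exponents : suc (q +ℕ u′) +ℕ suc (q +ℕ 3 *ℕ u′) ≡ suc (suc (q +ℕ 2 *ℕ u′) +ℕ (q +ℕ (u′ +ℕ u′)))
    exponents = solve-ℕ (q ∷ u′ ∷ [])

  fValue-d≡1 : ∀ d v u {ω} → IsPrimitiveRoot d ω → d ≡ 1 →
               fValue (suc v +ℕ u) (suc v) ω (fNum (suc v +ℕ u) (suc v)) (fDen (suc v +ℕ u) (suc v))
  fValue-d≡1 .1 v u isPrimitive ≡.refl = fValue-at-one v u (trans (sym (*-identityʳ _)) (proj₁ isPrimitive))

  fValue-d∣k : ∀ d v u {ω} → IsPrimitiveRoot d ω → 2 ≤ d → ∀ n′ k′ → suc v +ℕ u ≡ d *ℕ n′ → suc v ≡ d *ℕ k′ →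
               fValue (suc v +ℕ u) (suc v) ω ((n′ ∸ k′ +ℕ 1) *ℕ fNum n′ k′) (fDen n′ k′)
  fValue-d∣k (suc (suc e)) v u isPrimitive (s≤s (s≤s z≤n)) n′ k′ n≡ k≡ with divisible-coordinates e v u n′ k′ n≡ k≡
  ... | v′ , u′ , ≡.refl , ≡.refl , ≡.refl , ≡.refl = fValue-divisible e isPrimitive v′ u′

  fValue-d≡2-odd-k : ∀ d v u {ω} → IsPrimitiveRoot d ω → d ≡ 2 →
                     ∀ n′ k′ → suc v +ℕ u ≡ 2 *ℕ n′ → suc v +ℕ 1 ≡ 2 *ℕ k′ →
                     fValue (suc v +ℕ u) (suc v) ω ((n′ C (k′ ∸ 1)) *ℕ ((3 *ℕ n′ ∸ 2 *ℕ k′) C (n′ ∸ k′))) 1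
  fValue-d≡2-odd-k .2 v u isPrimitive ≡.refl n′ k′ n≡ k≡ with odd-coordinates v u n′ k′ n≡ k≡
  ... | v′ , u′ , ≡.refl , ≡.refl , ≡.refl , ≡.refl = fValue-odd isPrimitive v′ u′

  fValue-otherwise : ∀ d v u {ω} → IsPrimitiveRoot d ω → 2 ≤ d → d ∣ suc v +ℕ u → ¬ d ∣ suc v →
                     ¬ (d ≡ 2 × ¬ 2 ∣ suc v) → fValue (suc v +ℕ u) (suc v) ω 0 1
  -- d = r₀ + w₀ + 2 and k ≡ r₀ + 1 (mod d); r₀ = w₀ = 0 is the excluded case d = 2, k odd
  fValue-otherwise d v u isPrimitive 2≤d d∣n d∤k not-odd with nondivisible-coordinates d v u 2≤d d∣n d∤k
  ... | zero   , zero   , q , u′ , ≡.refl , ≡.refl , ≡.refl = contradiction (≡.refl , ¬2∣1+2q q) not-odd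
  ... | zero   , suc w₁ , q , u′ , ≡.refl , ≡.refl , ≡.refl = fValue-vanishes-at-remainder-one w₁ isPrimitive q u′
  ... | suc r₁ , w₀     , q , u′ , ≡.refl , ≡.refl , ≡.refl = fValue-vanishes-at-remainder-≥2 r₁ w₀ isPrimitive q u′

open import Data.Nat using (_≤_; _+_; _*_; _∸_)
open import Data.Nat.Divisibility using (_∣_)
open import Data.Nat.Combinatorics using (_C_)
open import Relation.Binary.PropositionalEquality using (_≡_; refl)
open import Relation.Nullary using (¬_)

lemma2p1 : ∀ {c ℓ : Level} (R : CommutativeRing c ℓ) →
    OverRing.IsIntegralDomain R → OverRing.HasCharZero R →
    (n k d : ℕ) → 1 ≤ k → k ≤ n → 1 ≤ d → d ∣ n →
    (ω : CommutativeRing.Carrier R) → OverRing.IsPrimitiveRoot R d ω →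
    (d ≡ 1 → OverRing.fValue R n k ω (fNum n k) (fDen n k))
    × (2 ≤ d → d ∣ k → (n′ k′ : ℕ) → n ≡ d * n′ → k ≡ d * k′ →
        OverRing.fValue R n k ω ((n′ ∸ k′ + 1) * fNum n′ k′) (fDen n′ k′))
    × (d ≡ 2 → ¬ (2 ∣ k) → (n′ k′ : ℕ) → n ≡ 2 * n′ → k + 1 ≡ 2 * k′ →
        OverRing.fValue R n k ω ((n′ C (k′ ∸ 1)) * ((3 * n′ ∸ 2 * k′) C (n′ ∸ k′))) 1)
    × (2 ≤ d → ¬ (d ∣ k) → ¬ (d ≡ 2 × ¬ (2 ∣ k)) → OverRing.fValue R n k ω 0 1)
lemma2p1 R isID charZero n k d 1≤k k≤n _ d∣n ω isPrimitive with NatArithmetic.coordinates 1≤k k≤n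
... | v , u , refl , refl =
  (λ d≡1 → fValue-d≡1 d v u isPrimitive d≡1) ,
  (λ 2≤d _ → fValue-d∣k d v u isPrimitive 2≤d) ,
  (λ d≡2 _ → fValue-d≡2-odd-k d v u isPrimitive d≡2) ,
  (λ 2≤d d∤k not-odd → fValue-otherwise d v u isPrimitive 2≤d d∣n d∤k not-odd)
  where open Cases R isID charZero
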